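{- Let $I=(i_1,\ldots,i_r)$ be a composition of $n$, and let $D_{\le I}$ be the set of $\sigma\in\mathfrak S_n$ whose descent set $\{j:\sigma(j)>\sigma(j+1)\}$ is contained in $\{i_1,i_1+i_2,\ldots,i_1+\cdots+i_{r-1}\}$. Then $$\sum_{\sigma\in D_{\le I}} x_{\operatorname{Sc}(\sigma^{ -1})}=\sum_{\sigma\in \operatorname{id}_{i_1}\Cup\cdots\Cup\operatorname{id}_{i_r}} x_{\operatorname{Sc}(\sigma)}=h_{i_1}(X_{i_2+\cdots+i_r})\,h_{i_2}(X_{i_3+\cdots+i_r})\cdots h_{i_{r-1}}(X_{i_r})\,h_{i_r}(X_0).$$
   Context: Permutations are words $\sigma=\sigma(1)\cdots\sigma(n)$. The set $\operatorname{id}_{i_1}\Cup\cdots\Cup\operatorname{id}_{i_r}$ (iterated shifted shuffle of identity permutations) is the set of $\sigma\in\mathfrak S_n$ such that, for each $p$, the letters $s_{p-1}+1,s_{p-1}+2,\ldots,s_p$ (where $s_p=i_1+\cdots+i_p$, $s_0=0$) appear in $\sigma$ from left to right in increasing order; it is the set of inverses of elements of $D_{\le I}$. The $x_0,x_1,\ldots$ are commuting indeterminates; for $c=(c_1,\ldots,c_n)$, $x_c=x_{c_1}\cdots x_{c_n}$. $X_m=\{x_0,\ldots,x_m\}$ and $h_k(X_m)$ is the complete homogeneous symmetric polynomial of degree $k$ in $x_0,\ldots,x_m$. Saillance code: $\operatorname{Sc}(\sigma)=(a_1,\ldots,a_n)$ where, if some letter greater than $i$ lies to the left of $i$ in $\sigma$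 and $b$ is the rightmost such letter, $a_i=n+1-b$ (the number of letters $\ge b$); otherwise $a_i=0$. -}

module Defs where

open import Level using (Level)
open import Algebra.Bundles using (CommutativeSemiring)
open import Data.Nat using (ℕ; zero; suc; _+_; _∸_; _<_; _≤_; _<?_; _≤?_; _≟_)
open import Data.Bool using (Bool; true; false; if_then_else_)
open import Data.List using (List; []; _∷_; map; concatMap; filter; length; takeWhile; foldr; upTo; last)
open import Data.Nat.ListAction using (sum)
open import Data.List.Relation.Unary.All using (All; all?)
open import Data.List.Relation.Unary.Linked using (Linked; linked?)
open import Data.List.Relation.Unary.Unique.DecPropositional _≟_ using (Unique; unique?)
open import Data.List.Membership.DecPropositional _≟_ using (_∈_; _∈?_)
open import Data.Maybe using (Maybe; just; nothing)
open import Relation.Nullary using (¬_; does)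
open import Relation.Nullary.Decidable using (¬?; _×-dec_)
open import Data.Product using (_×_)

-- Words and permutations.  A permutation σ ∈ 𝔖ₙ is the word
-- σ(1)⋯σ(n), a list of naturals; letters are 1,…,n.

oneTo : ℕ → List ℕ
oneTo n = map suc (upTo n)

words : ℕ → List ℕ → List (List ℕ)
words zero    A = [] ∷ []
words (suc k) A = concatMap (λ a → map (a ∷_) (words k A)) A

perms : ℕ → List (List ℕ)
perms n = filter unique? (words n (oneTo n))

posOf : ℕ → List ℕ → ℕ
posOf v []      = 0
posOf v (a ∷ w) = if does (v ≟ a) then 1 else suc (posOf v w)

inv : List ℕ → List ℕ
inv w = map (λ v → posOf v w) (oneTo (length w))

descentsFrom : ℕ → List ℕ → List ℕ
descentsFrom j []            = []
descentsFrom j (a ∷ [])      = []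
descentsFrom j (a ∷ b ∷ w)   =
  if does (b <? a) then j ∷ descentsFrom (suc j) (b ∷ w)
                   else descentsFrom (suc j) (b ∷ w)

descents : List ℕ → List ℕ
descents = descentsFrom 1

properPartialSumsFrom : ℕ → List ℕ → List ℕ
properPartialSumsFrom s []            = []
properPartialSumsFrom s (i ∷ [])      = []
properPartialSumsFrom s (i ∷ j ∷ I)   = (s + i) ∷ properPartialSumsFrom (s + i) (j ∷ I)

properPartialSums : List ℕ → List ℕ
properPartialSums = properPartialSumsFrom 0

InDLeq : List ℕ → List ℕ → Set
InDLeq I σ = All (λ j → j ∈ properPartialSums I) (descents σ)

inDLeq? : (I σ : List ℕ) → Relation.Nullary.Dec (InDLeq I σ)
inDLeq? I σ = all? (λ j → j ∈? properPartialSums I) (descents σ)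

-- Iterated shifted shuffle id_{i₁} ⋓ ⋯ ⋓ id_{i_r}:
-- for every block p, the letters s_{p-1}+1, …, s_p appear in σ from
-- left to right in increasing order, i.e. the subword of σ formed by
-- the letters a with s_{p-1} < a ≤ s_p is strictly increasing.

InBlock : ℕ → ℕ → ℕ → Set
InBlock s i a = (s < a) × (a ≤ s + i)

inBlock? : (s i a : ℕ) → Relation.Nullary.Dec (InBlock s i a)
inBlock? s i a = (s <? a) ×-dec (a ≤? s + i)

BlocksIncreasingFrom : ℕ → List ℕ → List ℕ → Set
BlocksIncreasingFrom s []      σ = Data.Unit.⊤
  where import Data.Unit
BlocksIncreasingFrom s (i ∷ I) σ =
  Linked _<_ (filter (inBlock? s i) σ) × BlocksIncreasingFrom (s + i) I σ

blocksIncreasingFrom? : (s : ℕ) (I σ : List ℕ) → Relation.Nullary.Dec (BlocksIncreasingFrom s I σ)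
blocksIncreasingFrom? s []      σ = Relation.Nullary.yes Data.Unit.tt
  where import Data.Unit
blocksIncreasingFrom? s (i ∷ I) σ =
  linked? Data.Nat._<?_ (filter (inBlock? s i) σ) ×-dec blocksIncreasingFrom? (s + i) I σ

InShuffle : List ℕ → List ℕ → Set
InShuffle I σ = BlocksIncreasingFrom 0 I σ

inShuffle? : (I σ : List ℕ) → Relation.Nullary.Dec (InShuffle I σ)
inShuffle? I σ = blocksIncreasingFrom? 0 I σ

scAt : ℕ → List ℕ → ℕ → ℕ
scAt n σ i with last (filter (i <?_) (takeWhile (λ a → ¬? (a ≟ i)) σ))
... | just b  = suc n ∸ b
... | nothing = 0

Sc : List ℕ → List ℕ
Sc σ = map (scAt (length σ) σ) (oneTo (length σ))

-- Polynomial expressions, evaluated in an arbitrary commutative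
-- semiring R at an arbitrary assignment x : ℕ → R of the variables
-- x₀, x₁, … .  (An identity holding for all R and all x is exactly an
-- identity in ℕ[x₀, x₁, …], the free commutative semiring.)

module Poly {c ℓ : Level} (R : CommutativeSemiring c ℓ)
            (x : ℕ → CommutativeSemiring.Carrier R) where
  open CommutativeSemiring R renaming (_+_ to _⊕_; _*_ to _⊗_)

  Σ[_]_ : {A : Set} → List A → (A → Carrier) → Carrier
  Σ[ xs ] f = foldr (λ a acc → f a ⊕ acc) 0# xs

  mono : List ℕ → Carrier
  mono c = foldr (λ k acc → x k ⊗ acc) 1# c

  WeaklyIncr : List ℕ → Set
  WeaklyIncr = Linked _≤_

  h : ℕ → ℕ → Carrier
  h k m = Σ[ filter (linked? _≤?_) (words k (upTo (suc m))) ] mono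

  hProduct : List ℕ → Carrier
  hProduct []      = 1#
  hProduct (i ∷ I) = h i (sum I) ⊗ hProduct I

  lhsD : List ℕ → Carrier
  lhsD I = Σ[ filter (inDLeq? I) (perms (sum I)) ] (λ σ → mono (Sc (inv σ)))

  lhsShuffle : List ℕ → Carrier
  lhsShuffle I = Σ[ filter (inShuffle? I) (perms (sum I)) ] (λ σ → mono (Sc σ))

module Submission where

-- Inverting permutations maps D_{≤I} onto the shuffle: σ⁻¹ has a descent at j exactly when
-- j + 1 precedes j in σ, while the shuffle asks that j precede j + 1 whenever both lie in one
-- block, i.e. whenever j is not a partial sum of I.
--
-- A word of id_{i₁} ⋓ (id_{i₂} ⋓ ⋯) is an interleaving of 1, …, i₁ with a word τ of the
-- shorter shuffle shifted up by i₁.  The letters above i₁ keep their codes from τ, while a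
-- letter a ≤ i₁ gets code 0, or n + 1 − b for the last letter b > i₁ before it.  Summed over
-- all interleavings, these codes satisfy the recursion of h_{i₁} in the variables x₀ and
-- x_{n+1−b}, whose indices are exactly 0, …, i₂ + ⋯ + i_r; induction on r concludes.

open import Algebra.Bundles using (CommutativeSemiring)
open import Data.Bool using (true; false; if_then_else_)
open import Data.Empty using (⊥-elim)
open import Data.List hiding (sum; lookup; find)
open import Data.List.Properties
open import Data.List.Membership.Propositional using (_∈_; _∉_; lose; find)
open import Data.List.Membership.Propositional.Properties
open import Data.List.Membership.Propositional.Properties.WithK using (unique∧set⇒bag)
open import Data.List.Relation.Binary.BagAndSetEquality using (∼bag⇒↭)
open import Data.List.Relation.Binary.Disjoint.Propositional using (Disjoint)
open import Data.List.Relation.Binary.Permutation.Propositional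
  using (_↭_; ↭-refl; ↭-sym; ↭-trans; ↭-prep; ↭⇒↭ₛ)
import Data.List.Relation.Binary.Permutation.Propositional as ↭
open import Data.List.Relation.Binary.Permutation.Propositional.Properties
  using (∈-resp-↭; ↭-length; drop-∷; ↭-empty-inv; shift; filter-↭; ++⁺ˡ; map⁺; ∷↭∷ʳ)
open import Data.List.Relation.Binary.Permutation.Setoid.Properties using (Unique-resp-↭)
open import Data.List.Relation.Unary.All as All using (All; []; _∷_)
import Data.List.Relation.Unary.All.Properties as All
open import Data.List.Relation.Unary.AllPairs as AllPairs using (AllPairs; []; _∷_)
import Data.List.Relation.Unary.AllPairs.Properties as AllPairs
open import Data.List.Relation.Unary.Any using (here; there)
open import Data.List.Relation.Unary.Any.Properties using (singleton⁻)
open import Data.List.Relation.Unary.Linked as Linked using (Linked; []; [-]; _∷_; linked?)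
open import Data.List.Relation.Unary.Linked.Properties using (Linked⇒All; AllPairs⇒Linked)
import Data.List.Relation.Unary.Linked.Properties as Linked
open import Data.List.Relation.Unary.Unique.Propositional using (Unique)
import Data.List.Relation.Unary.Unique.Propositional.Properties as Unique
open import Data.Maybe as Maybe using (Maybe; just; nothing)
open import Data.Nat
open import Data.Nat.ListAction using (sum)
open import Data.Nat.Properties
open import Data.List.Relation.Unary.Unique.DecPropositional _≟_ using (unique?)
open import Data.List.Membership.DecPropositional _≟_ using (_∈?_)
open import Data.Product using (_×_; _,_; proj₁; proj₂)
open import Data.Sum using (_⊎_; inj₁; inj₂; [_,_]′)
open import Data.Unit using (tt)
open import Function using (id; _∘_)
open import Function.Bundles using (_⇔_; mk⇔; Equivalence)
open import Level using (Level; 0ℓ)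
open import Relation.Binary.Definitions using (tri<; tri≈; tri>)
open import Relation.Binary.PropositionalEquality
open import Relation.Nullary using (¬_; Dec; yes; no; does)
open import Relation.Nullary.Decidable using (¬?; dec-true; dec-false; does-⇔)
open import Relation.Unary using (Pred; Decidable)

open import Defs

range : ℕ → ℕ → List ℕ
range k zero    = []
range k (suc m) = k ∷ range (suc k) m

∈-range⁻ : ∀ {y} k m → y ∈ range k m → k ≤ y × y < k + m
∈-range⁻ k (suc m) (here refl) = ≤-refl , subst (k <_) (sym (+-suc k m)) (s≤s (m≤m+n k m))
∈-range⁻ {y} k (suc m) (there p) with ∈-range⁻ (suc k) m p
... | k<y , y<k+m = <⇒≤ k<y , subst (y <_) (sym (+-suc k m)) y<k+m

∈-range⁺ : ∀ {y} k m → k ≤ y → y < k + m → y ∈ range k m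
∈-range⁺ k zero k≤y y<k rewrite +-identityʳ k = ⊥-elim (<⇒≱ y<k k≤y)
∈-range⁺ {y} k (suc m) k≤y y<k+m with k ≟ y
... | yes refl = here refl
... | no k≢y   = there (∈-range⁺ (suc k) m (≤∧≢⇒< k≤y k≢y) (subst (y <_) (+-suc k m) y<k+m))

range-strictlySorted : ∀ k m → AllPairs _<_ (range k m)
range-strictlySorted k zero    = []
range-strictlySorted k (suc m) =
  All.tabulate (λ y∈ → proj₁ (∈-range⁻ (suc k) m y∈)) ∷ range-strictlySorted (suc k) m

range-linked : ∀ k m → Linked _<_ (range k m)
range-linked k m = AllPairs⇒Linked (range-strictlySorted k m)

range-unique : ∀ k m → Unique (range k m)
range-unique k m = AllPairs.map <⇒≢ (range-strictlySorted k m)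

length-range : ∀ k m → length (range k m) ≡ m
length-range k zero    = refl
length-range k (suc m) = cong suc (length-range (suc k) m)

range-++ : ∀ k a b → range k (a + b) ≡ range k a ++ range (k + a) b
range-++ k zero    b = cong (λ z → range z b) (sym (+-identityʳ k))
range-++ k (suc a) b = cong (k ∷_) (trans (range-++ (suc k) a b)
  (cong (λ z → range (suc k) a ++ range z b) (sym (+-suc k a))))

map-+-range : ∀ i k m → map (i +_) (range k m) ≡ range (i + k) m
map-+-range i k zero    = refl
map-+-range i k (suc m) = cong (i + k ∷_)
  (trans (map-+-range i (suc k) m) (cong (λ z → range z m) (+-suc i k)))

map-+-map-∸ : ∀ i {l} → All (i ≤_) l → map (i +_) (map (_∸ i) l) ≡ l
map-+-map-∸ i []         = refl
map-+-map-∸ i (i≤ ∷ i≤s) = cong₂ _∷_ (m+[n∸m]≡n i≤) (map-+-map-∸ i i≤s)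

map-∸-range : ∀ i k m → map (_∸ i) (range (i + k) m) ≡ range k m
map-∸-range i k zero    = refl
map-∸-range i k (suc m) = cong₂ _∷_ (m+n∸m≡n i k)
  (trans (cong (λ z → map (_∸ i) (range z m)) (sym (+-suc i k))) (map-∸-range i (suc k) m))

complement-range↭ : ∀ m → map (suc m ∸_) (range 1 m) ↭ range 1 m
complement-range↭ zero    = ↭-refl
complement-range↭ (suc m) = begin
  suc m ∷ map (2 + m ∸_) (range 2 m) ≡⟨ cong (suc m ∷_) shifted ⟩
  suc m ∷ map (suc m ∸_) (range 1 m) ↭⟨ ↭-prep (suc m) (complement-range↭ m) ⟩
  suc m ∷ range 1 m                  ↭⟨ ∷↭∷ʳ (suc m) (range 1 m) ⟩
  range 1 m ++ range (1 + m) 1       ≡⟨ range-++ 1 m 1 ⟨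
  range 1 (m + 1)                    ≡⟨ cong (range 1) (+-comm m 1) ⟩
  range 1 (suc m)                    ∎
  where
  open ↭.PermutationReasoning
  shifted : map (2 + m ∸_) (range 2 m) ≡ map (suc m ∸_) (range 1 m)
  shifted = trans (cong (map (2 + m ∸_)) (sym (map-+-range 1 1 m))) (sym (map-∘ (range 1 m)))

upTo-range : ∀ n → upTo n ≡ range 0 n
upTo-range n = go id 0 n (λ _ → refl)
  where
  go : ∀ (f : ℕ → ℕ) k m → (∀ j → f j ≡ k + j) → applyUpTo f m ≡ range k m
  go f k zero    f≗ = refl
  go f k (suc m) f≗ = cong₂ _∷_ (trans (f≗ 0) (+-identityʳ k))
    (go (f ∘ suc) (suc k) m (λ j → trans (f≗ (suc j)) (+-suc k j)))

oneTo-range : ∀ n → oneTo n ≡ range 1 n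
oneTo-range n = trans (cong (map suc) (upTo-range n)) (map-+-range 1 0 n)

unique-↭ : ∀ {A : Set} {xs ys : List A} → xs ↭ ys → Unique xs → Unique ys
unique-↭ p = Unique-resp-↭ (setoid _) (↭⇒↭ₛ p)

sameMembers⇒↭ : ∀ {A : Set} {xs ys : List A} → Unique xs → Unique ys →
                (∀ {z} → z ∈ xs → z ∈ ys) → (∀ {z} → z ∈ ys → z ∈ xs) → xs ↭ ys
sameMembers⇒↭ ux uy f g = ∼bag⇒↭ (unique∧set⇒bag ux uy (mk⇔ f g))

Unique⇒AllPairs : ∀ {A : Set} {R : A → A → Set} {xs : List A} → Unique xs →
                  (∀ {a b} → a ∈ xs → b ∈ xs → a ≢ b → R a b) → AllPairs R xs
Unique⇒AllPairs []         R-distinct = []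
Unique⇒AllPairs (a∉ ∷ u) R-distinct =
  All.tabulate (λ b∈ → R-distinct (here refl) (there b∈) (All.lookup a∉ b∈))
  ∷ Unique⇒AllPairs u (λ a∈ b∈ → R-distinct (there a∈) (there b∈))

Unique-map⁺-local : ∀ {A B : Set} (f : A → B) {xs : List A} → Unique xs →
                    (∀ {a b} → a ∈ xs → b ∈ xs → f a ≡ f b → a ≡ b) → Unique (map f xs)
Unique-map⁺-local f []         _      = []
Unique-map⁺-local f (a∉ ∷ u) f-inj =
  All.tabulate fa∉ ∷ Unique-map⁺-local f u (λ a∈ b∈ → f-inj (there a∈) (there b∈))
  where
  fa∉ : ∀ {y} → y ∈ map f _ → f _ ≢ y
  fa∉ y∈ fa≡y with b , b∈ , y≡fb ← ∈-map⁻ f y∈ = All.lookup a∉ b∈ (f-inj (here refl) (there b∈) (trans fa≡y y≡fb))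

∈-∷-≢⁻ : ∀ {c y : ℕ} {σ} → y ∈ c ∷ σ → y ≢ c → y ∈ σ
∈-∷-≢⁻ (here y≡c) y≢c = ⊥-elim (y≢c y≡c)
∈-∷-≢⁻ (there y∈) _   = y∈

∈-++-∷⁻ : ∀ {A : Set} {z y : A} as bs → z ∈ as ++ y ∷ bs → z ≢ y → z ∈ as ++ bs
∈-++-∷⁻ as bs z∈ z≢y with ∈-++⁻ as z∈
... | inj₁ p           = ∈-++⁺ˡ p
... | inj₂ (here refl) = ⊥-elim (z≢y refl)
... | inj₂ (there p)   = ∈-++⁺ʳ as p

length-++-∷ : ∀ {A : Set} (as : List A) y bs → length (as ++ y ∷ bs) ≡ suc (length (as ++ bs))
length-++-∷ as y bs = begin
  length (as ++ y ∷ bs)          ≡⟨ length-++ as ⟩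
  length as + suc (length bs)    ≡⟨ +-suc (length as) (length bs) ⟩
  suc (length as + length bs)    ≡⟨ cong suc (length-++ as) ⟨
  suc (length (as ++ bs))        ∎
  where open ≡-Reasoning

unique-⊆⇒length≤ : ∀ {A : Set} {xs ys : List A} → Unique xs → All (_∈ ys) xs → length xs ≤ length ys
unique-⊆⇒length≤ [] [] = z≤n
unique-⊆⇒length≤ {xs = x ∷ xs} (x∉ ∷ u) (x∈ ∷ xs⊆) with ∈-∃++ x∈
... | as , bs , refl =
  subst (suc (length xs) ≤_) (sym (length-++-∷ as x bs))
    (s≤s (unique-⊆⇒length≤ u (All.zipWith (λ (x≢z , z∈) → ∈-++-∷⁻ as bs z∈ (≢-sym x≢z)) (x∉ , xs⊆))))

unique-⊆-length≥⇒⊇ : ∀ {xs ys : List ℕ} → Unique xs → All (_∈ ys) xs → length ys ≤ length xs →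
                     ∀ {y} → y ∈ ys → y ∈ xs
unique-⊆-length≥⇒⊇ {xs} u xs⊆ len {y} y∈ with y ∈? xs
... | yes y∈xs = y∈xs
... | no y∉xs with ∈-∃++ y∈
... | as , bs , refl = ⊥-elim (<⇒≱ short (≤-trans len (unique-⊆⇒length≤ u xs⊆bs)))
  where
  short : length (as ++ bs) < length (as ++ y ∷ bs)
  short = subst (length (as ++ bs) <_) (sym (length-++-∷ as y bs)) ≤-refl
  xs⊆bs : All (_∈ as ++ bs) xs
  xs⊆bs = All.tabulate (λ {z} z∈xs → ∈-++-∷⁻ as bs (All.lookup xs⊆ z∈xs)
                                      (λ z≡y → y∉xs (subst (_∈ xs) z≡y z∈xs)))

module _ {A : Set} {P Q : Pred A 0ℓ} (P? : Decidable P) (Q? : Decidable Q) where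

  filter-≐-local : ∀ xs → (∀ {a} → a ∈ xs → (P a → Q a) × (Q a → P a)) → filter P? xs ≡ filter Q? xs
  filter-≐-local []       P⇔Q = refl
  filter-≐-local (a ∷ xs) P⇔Q with P? a | Q? a
  ... | yes p | yes q = cong (a ∷_) (filter-≐-local xs (P⇔Q ∘ there))
  ... | yes p | no ¬q = ⊥-elim (¬q (proj₁ (P⇔Q (here refl)) p))
  ... | no ¬p | yes q = ⊥-elim (¬p (proj₂ (P⇔Q (here refl)) q))
  ... | no ¬p | no ¬q = filter-≐-local xs (P⇔Q ∘ there)

  filter-filter-implied : (∀ a → P a → Q a) → ∀ xs → filter P? (filter Q? xs) ≡ filter P? xs
  filter-filter-implied P⇒Q []       = refl
  filter-filter-implied P⇒Q (a ∷ xs) with Q? a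
  ... | no ¬q = trans (filter-filter-implied P⇒Q xs) (sym (filter-reject P? (¬q ∘ P⇒Q a)))
  ... | yes q with P? a
  ...   | yes _ = cong (a ∷_) (filter-filter-implied P⇒Q xs)
  ...   | no _  = filter-filter-implied P⇒Q xs

module _ {A B : Set} {P : Pred B 0ℓ} {Q : Pred A 0ℓ} (P? : Decidable P) (Q? : Decidable Q) (f : A → B) where

  filter-map : (∀ a → (P (f a) → Q a) × (Q a → P (f a))) → ∀ xs → filter P? (map f xs) ≡ map f (filter Q? xs)
  filter-map P∘f⇔Q []       = refl
  filter-map P∘f⇔Q (a ∷ xs) with P? (f a) | Q? a
  ... | yes p | yes q = cong (f a ∷_) (filter-map P∘f⇔Q xs)
  ... | yes p | no ¬q = ⊥-elim (¬q (proj₁ (P∘f⇔Q a) p))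
  ... | no ¬p | yes q = ⊥-elim (¬p (proj₂ (P∘f⇔Q a) q))
  ... | no ¬p | no ¬q = filter-map P∘f⇔Q xs

Linked-<-map-+⁺ : ∀ i {l} → Linked _<_ l → Linked _<_ (map (i +_) l)
Linked-<-map-+⁺ i lk = Linked.map⁺ (Linked.map (+-monoʳ-< i) lk)

Linked-<-map-+⁻ : ∀ i {l} → Linked _<_ (map (i +_) l) → Linked _<_ l
Linked-<-map-+⁻ i lk = Linked.map (λ {a} {b} → +-cancelˡ-< i a b) (Linked.map⁻ lk)

Linked-head-All : ∀ {R : ℕ → ℕ → Set} → (∀ {a b c} → R a b → R b c → R a c) →
                  ∀ {a l} → Linked R (a ∷ l) → All (R a) l
Linked-head-All R-trans {l = []}    _  = []
Linked-head-All R-trans {l = _ ∷ _} lk = Linked⇒All R-trans (Linked.head lk) (Linked.tail lk)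

Linked-<-head : ∀ {a l} → Linked _<_ (a ∷ l) → ∀ {y} → y ∈ l → a < y
Linked-<-head lk = All.lookup (Linked-head-All <-trans lk)

↗↭↗⇒≡ : ∀ {xs ys} → Linked _<_ xs → Linked _<_ ys → xs ↭ ys → xs ≡ ys
↗↭↗⇒≡ {[]}     {[]}     _  _  _ = refl
↗↭↗⇒≡ {[]}     {b ∷ ys} _  _  p with () ← ∈-resp-↭ (↭-sym p) (here refl)
↗↭↗⇒≡ {a ∷ xs} {[]}     _  _  p with () ← ∈-resp-↭ p (here refl)
↗↭↗⇒≡ {a ∷ xs} {b ∷ ys} lx ly p with ∈-resp-↭ p (here refl) | ∈-resp-↭ (↭-sym p) (here refl)
... | here refl | _         = cong (a ∷_) (↗↭↗⇒≡ (Linked.tail lx) (Linked.tail ly) (drop-∷ p))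
... | there a∈  | here refl = cong (a ∷_) (↗↭↗⇒≡ (Linked.tail lx) (Linked.tail ly) (drop-∷ p))
... | there a∈  | there b∈  = ⊥-elim (<-asym (Linked-<-head ly a∈) (Linked-<-head lx b∈))

∈-words⁻ : ∀ k (as : List ℕ) {w} → w ∈ words k as → length w ≡ k × All (_∈ as) w
∈-words⁻ zero    as (here refl) = refl , []
∈-words⁻ (suc k) as p with find (∈-concatMap⁻ (λ a → map (a ∷_) (words k as)) {xs = as} p)
... | a , a∈ , q with ∈-map⁻ (a ∷_) q
... | w , w∈ , refl with ∈-words⁻ k as w∈
... | len , w⊆ = cong suc len , a∈ ∷ w⊆

∈-words⁺ : ∀ k (as : List ℕ) {w} → length w ≡ k → All (_∈ as) w → w ∈ words k as
∈-words⁺ zero    as {[]}    refl []         = here refl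
∈-words⁺ (suc k) as {a ∷ w} refl (a∈ ∷ w⊆) =
  ∈-concatMap⁺ (λ a → map (a ∷_) (words k as)) (lose a∈ (∈-map⁺ (a ∷_) (∈-words⁺ k as refl w⊆)))

words-unique : ∀ k (as : List ℕ) → Unique as → Unique (words k as)
words-unique zero    as u = [] ∷ []
words-unique (suc k) as u =
  Unique.concat⁺ (All.map⁺ (All.tabulate (λ _ → Unique.map⁺ ∷-injectiveʳ (words-unique k as u))))
                 (AllPairs.map⁺ (AllPairs.map disjoint u))
  where
  disjoint : ∀ {a b} → a ≢ b → Disjoint (map (a ∷_) (words k as)) (map (b ∷_) (words k as))
  disjoint a≢b (p , q) with ∈-map⁻ _ p | ∈-map⁻ _ q
  ... | _ , _ , refl | _ , _ , refl = a≢b refl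

IsPerm : ℕ → List ℕ → Set
IsPerm n σ = σ ↭ range 1 n

IsPerm-bounds : ∀ {n σ a} → IsPerm n σ → a ∈ σ → 1 ≤ a × a < 1 + n
IsPerm-bounds {n} p a∈ = ∈-range⁻ 1 n (∈-resp-↭ p a∈)

IsPerm-unique : ∀ {n σ} → IsPerm n σ → Unique σ
IsPerm-unique {n} p = unique-↭ (↭-sym p) (range-unique 1 n)

IsPerm-length : ∀ {n σ} → IsPerm n σ → length σ ≡ n
IsPerm-length {n} p = trans (↭-length p) (length-range 1 n)

IsPerm-intro : ∀ n {w} → length w ≡ n → All (_∈ range 1 n) w → Unique w → IsPerm n w
IsPerm-intro n len w⊆ u =
  sameMembers⇒↭ u (range-unique 1 n) (All.lookup w⊆)
    (unique-⊆-length≥⇒⊇ u w⊆ (≤-reflexive (trans (length-range 1 n) (sym len))))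

perms-unique : ∀ n → Unique (perms n)
perms-unique n = Unique.filter⁺ unique?
  (words-unique n (oneTo n) (subst Unique (sym (oneTo-range n)) (range-unique 1 n)))

∈perms⁻ : ∀ n {σ} → σ ∈ perms n → IsPerm n σ
∈perms⁻ n {σ} p with ∈-filter⁻ unique? {xs = words n (oneTo n)} p
... | w∈ , u with ∈-words⁻ n (oneTo n) w∈
... | len , σ⊆ = IsPerm-intro n len (subst (λ l → All (_∈ l) σ) (oneTo-range n) σ⊆) u

∈perms⁺ : ∀ n {σ} → IsPerm n σ → σ ∈ perms n
∈perms⁺ n {σ} p = ∈-filter⁺ unique?
  (∈-words⁺ n (oneTo n) (IsPerm-length p)
     (subst (λ l → All (_∈ l) σ) (sym (oneTo-range n)) (All.tabulate (∈-resp-↭ p))))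
  (IsPerm-unique p)

nondecreasingWords : ℕ → List ℕ → List (List ℕ)
nondecreasingWords zero    L       = [] ∷ []
nondecreasingWords (suc k) []      = []
nondecreasingWords (suc k) (c ∷ L) =
  map (c ∷_) (nondecreasingWords k (c ∷ L)) ++ nondecreasingWords (suc k) L

private
  Linked-≤-∷ : ∀ {c L w} → All (c <_) L → All (_∈ c ∷ L) w → Linked _≤_ w → Linked _≤_ (c ∷ w)
  Linked-≤-∷ {w = []}    c<L _                  _  = [-]
  Linked-≤-∷ {w = _ ∷ _} c<L (here refl ∷ _)    lk = ≤-refl ∷ lk
  Linked-≤-∷ {w = _ ∷ _} c<L (there b∈ ∷ _)     lk = <⇒≤ (All.lookup c<L b∈) ∷ lk

∈-nondecreasingWords⁻ : ∀ k L {w} → AllPairs _<_ L → w ∈ nondecreasingWords k L →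
                        length w ≡ k × All (_∈ L) w × Linked _≤_ w
∈-nondecreasingWords⁻ zero    L       _ (here refl) = refl , [] , []
∈-nondecreasingWords⁻ (suc k) (c ∷ L) s@(c<L ∷ sL) p with ∈-++⁻ (map (c ∷_) (nondecreasingWords k (c ∷ L))) p
... | inj₂ q with ∈-nondecreasingWords⁻ (suc k) L sL q
...   | len , w⊆ , lk = len , All.map there w⊆ , lk
∈-nondecreasingWords⁻ (suc k) (c ∷ L) s@(c<L ∷ sL) p | inj₁ q with ∈-map⁻ (c ∷_) q
...   | w , w∈ , refl with ∈-nondecreasingWords⁻ k (c ∷ L) s w∈
...     | len , w⊆ , lk = cong suc len , here refl ∷ w⊆ , Linked-≤-∷ c<L w⊆ lk

∈-nondecreasingWords⁺ : ∀ k L {w} → AllPairs _<_ L → length w ≡ k → All (_∈ L) w → Linked _≤_ w →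
                        w ∈ nondecreasingWords k L
∈-nondecreasingWords⁺ zero    L       {[]}    _ refl [] _ = here refl
∈-nondecreasingWords⁺ (suc k) (c ∷ L) {a ∷ w} s refl (here refl ∷ w⊆) lk =
  ∈-++⁺ˡ (∈-map⁺ (c ∷_) (∈-nondecreasingWords⁺ k (c ∷ L) s refl w⊆ (Linked.tail lk)))
∈-nondecreasingWords⁺ (suc k) (c ∷ L) {a ∷ w} (c<L ∷ sL) refl (there a∈ ∷ w⊆) lk =
  ∈-++⁺ʳ (map (c ∷_) (nondecreasingWords k (c ∷ L)))
    (∈-nondecreasingWords⁺ (suc k) L sL refl (a∈ ∷ w⊆L) lk)
  where
  -- every later letter is ≥ a > c, so none of them is c
  w⊆L : All (_∈ L) w
  w⊆L = All.zipWith (λ { (here refl , a≤c) → ⊥-elim (<⇒≱ (All.lookup c<L a∈) a≤c)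
                       ; (there y∈ , _)    → y∈ })
                    (w⊆ , Linked-head-All ≤-trans lk)

nondecreasingWords-unique : ∀ k L → AllPairs _<_ L → Unique (nondecreasingWords k L)
nondecreasingWords-unique zero    L       _ = [] ∷ []
nondecreasingWords-unique (suc k) []      _ = []
nondecreasingWords-unique (suc k) (c ∷ L) s@(c<L ∷ sL) =
  Unique.++⁺ (Unique.map⁺ ∷-injectiveʳ (nondecreasingWords-unique k (c ∷ L) s))
             (nondecreasingWords-unique (suc k) L sL) disjoint
  where
  disjoint : ∀ {v} → ¬ (v ∈ map (c ∷_) (nondecreasingWords k (c ∷ L)) × v ∈ nondecreasingWords (suc k) L)
  disjoint (p , q) with ∈-map⁻ (c ∷_) p
  ... | _ , _ , refl with ∈-nondecreasingWords⁻ (suc k) L sL q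
  ...   | _ , c∈ ∷ _ , _ = <-irrefl refl (All.lookup c<L c∈)

nondecreasing-words↭nondecreasingWords : ∀ k m →
  filter (linked? _≤?_) (words k (upTo (suc m))) ↭ nondecreasingWords k (upTo (suc m))
nondecreasing-words↭nondecreasingWords k m rewrite upTo-range (suc m) =
  sameMembers⇒↭ (Unique.filter⁺ (linked? _≤?_) (words-unique k _ (range-unique 0 (suc m))))
                (nondecreasingWords-unique k _ sorted) to from
  where
  sorted = range-strictlySorted 0 (suc m)
  to : ∀ {w} → w ∈ filter (linked? _≤?_) (words k (range 0 (suc m))) → w ∈ nondecreasingWords k (range 0 (suc m))
  to w∈ with ∈-filter⁻ (linked? _≤?_) {xs = words k (range 0 (suc m))} w∈
  ... | w∈words , lk with ∈-words⁻ k _ w∈words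
  ... | len , w⊆ = ∈-nondecreasingWords⁺ k _ sorted len w⊆ lk
  from : ∀ {w} → w ∈ nondecreasingWords k (range 0 (suc m)) → w ∈ filter (linked? _≤?_) (words k (range 0 (suc m)))
  from w∈ with ∈-nondecreasingWords⁻ k _ sorted w∈
  ... | len , w⊆ , lk = ∈-filter⁺ (linked? _≤?_) (∈-words⁺ k _ len w⊆) lk

-- Interleavings

merges : List ℕ → List ℕ → List (List ℕ)
merges []      v       = v ∷ []
merges (a ∷ u) []      = (a ∷ u) ∷ []
merges (a ∷ u) (b ∷ v) = map (a ∷_) (merges u (b ∷ v)) ++ map (b ∷_) (merges (a ∷ u) v)

merges-[] : ∀ u → merges u [] ≡ u ∷ []
merges-[] []      = refl
merges-[] (a ∷ u) = refl

∈merges⇒↭ : ∀ u v {σ} → σ ∈ merges u v → σ ↭ u ++ v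
∈merges⇒↭ []      v       (here refl) = ↭-refl
∈merges⇒↭ (a ∷ u) []      (here refl) = ↭-prep a (↭.↭-reflexive (sym (++-identityʳ u)))
∈merges⇒↭ (a ∷ u) (b ∷ v) p with ∈-++⁻ (map (a ∷_) (merges u (b ∷ v))) p
... | inj₁ q with ∈-map⁻ (a ∷_) q
...   | σ , σ∈ , refl = ↭-prep a (∈merges⇒↭ u (b ∷ v) σ∈)
∈merges⇒↭ (a ∷ u) (b ∷ v) p | inj₂ q with ∈-map⁻ (b ∷_) q
...   | σ , σ∈ , refl = ↭-trans (↭-prep b (∈merges⇒↭ (a ∷ u) v σ∈)) (↭-sym (shift b (a ∷ u) v))

∷-∈merges-left : ∀ c {u v σ} → σ ∈ merges u v → c ∷ σ ∈ merges (c ∷ u) v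
∷-∈merges-left c {u} {[]}    σ∈ with refl ← singleton⁻ (subst (_ ∈_) (merges-[] u) σ∈) = here refl
∷-∈merges-left c {u} {b ∷ v} σ∈ = ∈-++⁺ˡ (∈-map⁺ (c ∷_) σ∈)

∷-∈merges-right : ∀ c {u v σ} → σ ∈ merges u v → c ∷ σ ∈ merges u (c ∷ v)
∷-∈merges-right c {[]}    σ∈ with refl ← singleton⁻ σ∈ = here refl
∷-∈merges-right c {a ∷ u} {v} σ∈ = ∈-++⁺ʳ (map (a ∷_) (merges u (c ∷ v))) (∈-map⁺ (c ∷_) σ∈)

module _ (i : ℕ) where

  private
    filter-≤-all : ∀ {u} → All (_≤ i) u → filter (_≤? i) u ≡ u
    filter-≤-all = filter-all (_≤? i)
    filter->-none : ∀ {u} → All (_≤ i) u → filter (i <?_) u ≡ []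
    filter->-none u≤ = filter-none (i <?_) (All.map (λ a≤ i<a → <⇒≱ i<a a≤) u≤)
    filter-≤-none : ∀ {v} → All (i <_) v → filter (_≤? i) v ≡ []
    filter-≤-none v> = filter-none (_≤? i) (All.map (λ i<a a≤ → <⇒≱ i<a a≤) v>)
    filter->-all : ∀ {v} → All (i <_) v → filter (i <?_) v ≡ v
    filter->-all = filter-all (i <?_)

  ∈merges⇒filters : ∀ u v {σ} → All (_≤ i) u → All (i <_) v → σ ∈ merges u v →
                    filter (_≤? i) σ ≡ u × filter (i <?_) σ ≡ v
  ∈merges⇒filters []      v       _ v> (here refl) = filter-≤-none v> , filter->-all v>
  ∈merges⇒filters (a ∷ u) []      u≤ _ (here refl) = filter-≤-all u≤ , filter->-none u≤
  ∈merges⇒filters (a ∷ u) (b ∷ v) u≤@(a≤ ∷ u≤′) v>@(b> ∷ v>′) p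
    with ∈-++⁻ (map (a ∷_) (merges u (b ∷ v))) p
  ... | inj₁ q with ∈-map⁻ (a ∷_) q
  ...   | σ , σ∈ , refl with ∈merges⇒filters u (b ∷ v) u≤′ v> σ∈
  ...     | e≤ , e> = trans (filter-accept (_≤? i) a≤) (cong (a ∷_) e≤) ,
                      trans (filter-reject (i <?_) (λ i<a → <⇒≱ i<a a≤)) e>
  ∈merges⇒filters (a ∷ u) (b ∷ v) u≤@(a≤ ∷ u≤′) v>@(b> ∷ v>′) p | inj₂ q with ∈-map⁻ (b ∷_) q
  ...   | σ , σ∈ , refl with ∈merges⇒filters (a ∷ u) v u≤ v>′ σ∈
  ...     | e≤ , e> = trans (filter-reject (_≤? i) (λ b≤ → <⇒≱ b> b≤)) e≤ ,
                      trans (filter-accept (i <?_) b>) (cong (b ∷_) e>)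

  filters⇒∈merges : ∀ σ → σ ∈ merges (filter (_≤? i) σ) (filter (i <?_) σ)
  filters⇒∈merges []      = here refl
  filters⇒∈merges (c ∷ σ) = byCase (c ≤? i)
    where
    byCase : Dec (c ≤ i) → c ∷ σ ∈ merges (filter (_≤? i) (c ∷ σ)) (filter (i <?_) (c ∷ σ))
    byCase (yes c≤) = subst₂ (λ u v → c ∷ σ ∈ merges u v)
      (sym (filter-accept (_≤? i) c≤)) (sym (filter-reject (i <?_) (λ i<c → <⇒≱ i<c c≤)))
      (∷-∈merges-left c {filter (_≤? i) σ} {filter (i <?_) σ} (filters⇒∈merges σ))
    byCase (no c≰)  = subst₂ (λ u v → c ∷ σ ∈ merges u v)
      (sym (filter-reject (_≤? i) c≰)) (sym (filter-accept (i <?_) (≰⇒> c≰)))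
      (∷-∈merges-right c {filter (_≤? i) σ} {filter (i <?_) σ} (filters⇒∈merges σ))

  merges-unique : ∀ u v → All (_≤ i) u → All (i <_) v → Unique (merges u v)
  merges-unique []      v       _ _ = [] ∷ []
  merges-unique (a ∷ u) []      _ _ = [] ∷ []
  merges-unique (a ∷ u) (b ∷ v) u≤@(a≤ ∷ u≤′) v>@(b> ∷ v>′) =
    Unique.++⁺ (Unique.map⁺ ∷-injectiveʳ (merges-unique u (b ∷ v) u≤′ v>))
               (Unique.map⁺ ∷-injectiveʳ (merges-unique (a ∷ u) v u≤ v>′)) disjoint
    where
    disjoint : ∀ {w} → ¬ (w ∈ map (a ∷_) (merges u (b ∷ v)) × w ∈ map (b ∷_) (merges (a ∷ u) v))
    disjoint (p , q) with ∈-map⁻ (a ∷_) p | ∈-map⁻ (b ∷_) q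
    ... | _ , _ , refl | _ , _ , refl = <⇒≱ b> a≤

-- The saillance code

codeOf : ℕ → Maybe ℕ → ℕ
codeOf n (just b) = suc n ∸ b
codeOf n nothing  = 0

before : ℕ → List ℕ → List ℕ
before j = takeWhile (λ a → ¬? (a ≟ j))

scAt-codeOf : ∀ n w j → scAt n w j ≡ codeOf n (last (filter (j <?_) (before j w)))
scAt-codeOf n w j with last (filter (j <?_) (before j w))
... | just b  = refl
... | nothing = refl

module _ {P : Pred ℕ 0ℓ} (P? : Decidable P) where

  takeWhile-reject : ∀ {x xs} → ¬ P x → takeWhile P? (x ∷ xs) ≡ []
  takeWhile-reject {x} ¬p with P? x
  ... | yes p = ⊥-elim (¬p p)
  ... | no _  = refl

  takeWhile-accept : ∀ {x xs} → P x → takeWhile P? (x ∷ xs) ≡ x ∷ takeWhile P? xs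
  takeWhile-accept {x} p with P? x
  ... | yes _ = refl
  ... | no ¬p = ⊥-elim (¬p p)

before-here : ∀ a w → before a (a ∷ w) ≡ []
before-here a w = takeWhile-reject (λ c → ¬? (c ≟ a)) (λ a≢a → a≢a refl)

before-there : ∀ {a c} w → c ≢ a → before a (c ∷ w) ≡ c ∷ before a w
before-there {a} w = takeWhile-accept (λ c → ¬? (c ≟ a))

before-++-∷ : ∀ {a} p w → All (_≢ a) p → before a (p ++ a ∷ w) ≡ p
before-++-∷ {a} [] w [] = before-here a w
before-++-∷ (c ∷ p) w (c≢a ∷ p≢) = trans (before-there (p ++ _ ∷ w) c≢a) (cong (c ∷_) (before-++-∷ p w p≢))

filter-before-filter : ∀ {P Q : Pred ℕ 0ℓ} (P? : Decidable P) (Q? : Decidable Q) k σ → P k → (∀ a → Q a → P a) →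
                       filter Q? (before k σ) ≡ filter Q? (before k (filter P? σ))
filter-before-filter P? Q? k []      Pk Q⇒P = refl
filter-before-filter P? Q? k (c ∷ σ) Pk Q⇒P with c ≟ k
... | yes refl = begin
  filter Q? (before c (c ∷ σ))             ≡⟨ cong (filter Q?) (before-here c σ) ⟩
  []                                       ≡⟨ cong (filter Q?) (before-here c (filter P? σ)) ⟨
  filter Q? (before c (c ∷ filter P? σ))   ≡⟨ cong (filter Q? ∘ before c) (filter-accept P? Pk) ⟨
  filter Q? (before c (filter P? (c ∷ σ))) ∎
  where open ≡-Reasoning
... | no c≢k rewrite before-there σ c≢k with P? c
...   | yes Pc rewrite before-there (filter P? σ) c≢k with Q? c
...     | yes _ = cong (c ∷_) (filter-before-filter P? Q? k σ Pk Q⇒P)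
...     | no _  = filter-before-filter P? Q? k σ Pk Q⇒P
filter-before-filter P? Q? k (c ∷ σ) Pk Q⇒P | no c≢k | no ¬Pc with Q? c
... | yes Qc = ⊥-elim (¬Pc (Q⇒P c Qc))
... | no _   = filter-before-filter P? Q? k σ Pk Q⇒P

before-map-+ : ∀ i j τ → before (i + j) (map (i +_) τ) ≡ map (i +_) (before j τ)
before-map-+ i j []      = refl
before-map-+ i j (t ∷ τ) with t ≟ j
... | yes refl = trans (before-here (i + t) (map (i +_) τ)) (cong (map (i +_)) (sym (before-here t τ)))
... | no t≢j   = begin
  before (i + j) (i + t ∷ map (i +_) τ) ≡⟨ before-there (map (i +_) τ) (t≢j ∘ +-cancelˡ-≡ i t j) ⟩
  i + t ∷ before (i + j) (map (i +_) τ) ≡⟨ cong (i + t ∷_) (before-map-+ i j τ) ⟩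
  map (i +_) (t ∷ before j τ)           ≡⟨ cong (map (i +_)) (before-there τ t≢j) ⟨
  map (i +_) (before j (t ∷ τ))         ∎
  where open ≡-Reasoning

last-∷ʳ : ∀ (l : List ℕ) b → last (l ++ b ∷ []) ≡ just b
last-∷ʳ []          b = refl
last-∷ʳ (a ∷ [])    b = refl
last-∷ʳ (a ∷ c ∷ l) b = last-∷ʳ (c ∷ l) b

-- The code of a letter i + j > i only sees the letters > i, which form a shifted copy of τ.
scAt-shift : ∀ i m σ τ j → 1 ≤ j → filter (i <?_) σ ≡ map (i +_) τ →
             scAt (i + m) σ (i + j) ≡ scAt m τ j
scAt-shift i m σ τ j 1≤j σ>i≡τ+i = begin
  scAt (i + m) σ (i + j)
    ≡⟨ scAt-codeOf (i + m) σ (i + j) ⟩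
  codeOf (i + m) (last (filter ((i + j) <?_) (before (i + j) σ)))
    ≡⟨ cong (codeOf (i + m) ∘ last) (filter-before-filter (i <?_) ((i + j) <?_) (i + j) σ
          (subst (_≤ i + j) (+-comm i 1) (+-monoʳ-≤ i 1≤j)) (λ a → ≤-<-trans (m≤m+n i j))) ⟩
  codeOf (i + m) (last (filter ((i + j) <?_) (before (i + j) (filter (i <?_) σ))))
    ≡⟨ cong (codeOf (i + m) ∘ last ∘ filter ((i + j) <?_))
            (trans (cong (before (i + j)) σ>i≡τ+i) (before-map-+ i j τ)) ⟩
  codeOf (i + m) (last (filter ((i + j) <?_) (map (i +_) (before j τ))))
    ≡⟨ cong (codeOf (i + m) ∘ last) (filter-map ((i + j) <?_) (j <?_) (i +_)
          (λ a → +-cancelˡ-< i j a , +-monoʳ-< i) (before j τ)) ⟩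
  codeOf (i + m) (last (map (i +_) (filter (j <?_) (before j τ))))
    ≡⟨ cong (codeOf (i + m)) (last-map (i +_) (filter (j <?_) (before j τ))) ⟩
  codeOf (i + m) (Maybe.map (i +_) (last (filter (j <?_) (before j τ))))
    ≡⟨ codeOf-shift (last (filter (j <?_) (before j τ))) ⟩
  codeOf m (last (filter (j <?_) (before j τ)))
    ≡⟨ scAt-codeOf m τ j ⟨
  scAt m τ j ∎
  where
  open ≡-Reasoning
  codeOf-shift : ∀ mb → codeOf (i + m) (Maybe.map (i +_) mb) ≡ codeOf m mb
  codeOf-shift nothing  = refl
  codeOf-shift (just b) = trans (cong (_∸ (i + b)) (sym (+-suc i m))) ([m+n]∸[m+o]≡n∸o i (suc m) b)

lastAboveCode : ℕ → ℕ → List ℕ → ℕ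
lastAboveCode i n p = codeOf n (last (filter (i <?_) p))

Separated : ℕ → ℕ → List ℕ → Set
Separated i a p = All (λ c → c < a ⊎ i < c) p

Separated-∷ʳ-below : ∀ i a p → Separated i a p → Separated i (suc a) (p ++ a ∷ [])
Separated-∷ʳ-below i a p sep = All.++⁺ (All.map [ inj₁ ∘ m<n⇒m<1+n , inj₂ ]′ sep) (inj₁ ≤-refl ∷ [])

Separated-∷ʳ-above : ∀ i a p b → i < b → Separated i a p → Separated i a (p ++ b ∷ [])
Separated-∷ʳ-above i a p b i<b sep = All.++⁺ sep (inj₂ i<b ∷ [])

scAt-below : ∀ i n a p w → a ≤ i → Separated i a p →
             scAt n (p ++ a ∷ w) a ≡ lastAboveCode i n p
scAt-below i n a p w a≤i p-sep = begin
  scAt n (p ++ a ∷ w) a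
    ≡⟨ scAt-codeOf n (p ++ a ∷ w) a ⟩
  codeOf n (last (filter (a <?_) (before a (p ++ a ∷ w))))
    ≡⟨ cong (codeOf n ∘ last ∘ filter (a <?_)) (before-++-∷ p w (All.map ≢a p-sep)) ⟩
  codeOf n (last (filter (a <?_) p))
    ≡⟨ cong (codeOf n ∘ last) (filter-≐-local (a <?_) (i <?_) p above-a⇔above-i) ⟩
  lastAboveCode i n p ∎
  where
  open ≡-Reasoning
  ≢a : ∀ {c} → c < a ⊎ i < c → c ≢ a
  ≢a (inj₁ c<a) refl = <-irrefl refl c<a
  ≢a (inj₂ i<c) refl = <-irrefl refl (≤-<-trans a≤i i<c)
  above-a⇔above-i : ∀ {c} → c ∈ p → (a < c → i < c) × (i < c → a < c)
  above-a⇔above-i c∈ = [ (λ c<a a<c → ⊥-elim (<-asym a<c c<a)) , (λ i<c _ → i<c) ]′ (All.lookup p-sep c∈) ,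
                       ≤-<-trans a≤i

lastAboveCode-∷ʳ-below : ∀ i n p a → a ≤ i → lastAboveCode i n (p ++ a ∷ []) ≡ lastAboveCode i n p
lastAboveCode-∷ʳ-below i n p a a≤i = cong (codeOf n ∘ last) (begin
  filter (i <?_) (p ++ a ∷ [])              ≡⟨ filter-++ (i <?_) p (a ∷ []) ⟩
  filter (i <?_) p ++ filter (i <?_) (a ∷ []) ≡⟨ cong (filter (i <?_) p ++_) (filter-reject (i <?_) (λ i<a → <⇒≱ i<a a≤i)) ⟩
  filter (i <?_) p ++ []                    ≡⟨ ++-identityʳ _ ⟩
  filter (i <?_) p                          ∎)
  where open ≡-Reasoning

lastAboveCode-∷ʳ-above : ∀ i n p b → i < b → lastAboveCode i n (p ++ b ∷ []) ≡ suc n ∸ b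
lastAboveCode-∷ʳ-above i n p b i<b = cong (codeOf n) (begin
  last (filter (i <?_) (p ++ b ∷ []))                ≡⟨ cong last (filter-++ (i <?_) p (b ∷ [])) ⟩
  last (filter (i <?_) p ++ filter (i <?_) (b ∷ [])) ≡⟨ cong (λ l → last (filter (i <?_) p ++ l)) (filter-accept (i <?_) i<b) ⟩
  last (filter (i <?_) p ++ b ∷ [])                  ≡⟨ last-∷ʳ (filter (i <?_) p) b ⟩
  just b                                             ∎)
  where open ≡-Reasoning

Sc-≡ : ∀ {n σ} → IsPerm n σ → Sc σ ≡ map (scAt n σ) (range 1 n)
Sc-≡ {n} {σ} p = trans (cong (λ l → map (scAt l σ) (oneTo l)) (IsPerm-length p)) (cong (map (scAt n σ)) (oneTo-range n))

-- Decomposing the shuffle along its first block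

shuffle : List ℕ → List (List ℕ)
shuffle I = filter (inShuffle? I) (perms (sum I))

shuffle-unique : ∀ I → Unique (shuffle I)
shuffle-unique I = Unique.filter⁺ (inShuffle? I) (perms-unique (sum I))

∈shuffle⁻ : ∀ I {σ} → σ ∈ shuffle I → IsPerm (sum I) σ × InShuffle I σ
∈shuffle⁻ I σ∈ with σ∈perms , sh ← ∈-filter⁻ (inShuffle? I) {xs = perms (sum I)} σ∈ = ∈perms⁻ (sum I) σ∈perms , sh

∈shuffle⁺ : ∀ I {σ} → IsPerm (sum I) σ → InShuffle I σ → σ ∈ shuffle I
∈shuffle⁺ I p sh = ∈-filter⁺ (inShuffle? I) (∈perms⁺ (sum I) p) sh

∈shuffle⇒IsPerm : ∀ I {σ} → σ ∈ shuffle I → IsPerm (sum I) σ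
∈shuffle⇒IsPerm I = proj₁ ∘ ∈shuffle⁻ I

module _ (i : ℕ) where

  blocksIncreasing-shift : ∀ I t s σ τ → t ≡ i + s → filter (i <?_) σ ≡ map (i +_) τ →
                           BlocksIncreasingFrom t I σ ⇔ BlocksIncreasingFrom s I τ
  blocksIncreasing-shift []      t s σ τ t≡ σ>i≡ = mk⇔ (λ _ → tt) (λ _ → tt)
  blocksIncreasing-shift (j ∷ I) t s σ τ t≡ σ>i≡ =
    mk⇔ (λ (lk , rest) → Linked-<-map-+⁻ i (subst (Linked _<_) block≡ lk) , Equivalence.to rest⇔ rest)
        (λ (lk , rest) → subst (Linked _<_) (sym block≡) (Linked-<-map-+⁺ i lk) , Equivalence.from rest⇔ rest)
    where
    t+j≡ : t + j ≡ i + (s + j)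
    t+j≡ = trans (cong (_+ j) t≡) (+-assoc i s j)
    rest⇔ = blocksIncreasing-shift I (t + j) (s + j) σ τ t+j≡ σ>i≡
    inBlock-shift : ∀ a → (InBlock t j (i + a) → InBlock s j a) × (InBlock s j a → InBlock t j (i + a))
    inBlock-shift a = (λ (t< , ≤t+j) → +-cancelˡ-< i s a (subst (_< i + a) t≡ t<) ,
                                      +-cancelˡ-≤ i a (s + j) (subst (i + a ≤_) t+j≡ ≤t+j)) ,
                      (λ (s< , ≤s+j) → subst (_< i + a) (sym t≡) (+-monoʳ-< i s<) ,
                                      subst (i + a ≤_) (sym t+j≡) (+-monoʳ-≤ i ≤s+j))
    block≡ : filter (inBlock? t j) σ ≡ map (i +_) (filter (inBlock? s j) τ)
    block≡ = begin
      filter (inBlock? t j) σ                   ≡⟨ filter-filter-implied (inBlock? t j) (i <?_)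
                                                     (λ a (t<a , _) → ≤-<-trans (subst (i ≤_) (sym t≡) (m≤m+n i s)) t<a) σ ⟨
      filter (inBlock? t j) (filter (i <?_) σ)  ≡⟨ cong (filter (inBlock? t j)) σ>i≡ ⟩
      filter (inBlock? t j) (map (i +_) τ)      ≡⟨ filter-map (inBlock? t j) (inBlock? s j) (i +_) inBlock-shift τ ⟩
      map (i +_) (filter (inBlock? s j) τ)      ∎
      where open ≡-Reasoning

  range-below : All (_≤ i) (range 1 i)
  range-below = All.tabulate (λ y∈ → s≤s⁻¹ (proj₂ (∈-range⁻ 1 i y∈)))

  map-+-above : ∀ {m τ} → IsPerm m τ → All (i <_) (map (i +_) τ)
  map-+-above p = All.map⁺ (All.tabulate (λ {a} a∈ →
    subst (_≤ i + a) (+-comm i 1) (+-monoʳ-≤ i (proj₁ (IsPerm-bounds p a∈)))))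

  mergesWithBlock : List ℕ → List (List ℕ)
  mergesWithBlock τ = merges (range 1 i) (map (i +_) τ)

  ∈mergesWithBlock⇒filters : ∀ {m τ σ} → IsPerm m τ → σ ∈ mergesWithBlock τ →
                             filter (_≤? i) σ ≡ range 1 i × filter (i <?_) σ ≡ map (i +_) τ
  ∈mergesWithBlock⇒filters p = ∈merges⇒filters i _ _ range-below (map-+-above p)

  ∈mergesWithBlock⇒IsPerm : ∀ {m τ σ} → IsPerm m τ → σ ∈ mergesWithBlock τ → IsPerm (i + m) σ
  ∈mergesWithBlock⇒IsPerm {m} {τ} {σ} p σ∈ = begin
    σ                            ↭⟨ ∈merges⇒↭ (range 1 i) (map (i +_) τ) σ∈ ⟩
    range 1 i ++ map (i +_) τ    ↭⟨ ++⁺ˡ (range 1 i) (map⁺ (i +_) p) ⟩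
    range 1 i ++ map (i +_) (range 1 m) ≡⟨ cong (range 1 i ++_) (trans (map-+-range i 1 m) (cong (λ z → range z m) (+-comm i 1))) ⟩
    range 1 i ++ range (1 + i) m ≡⟨ range-++ 1 i m ⟨
    range 1 (i + m)              ∎
    where open ↭.PermutationReasoning

  firstBlock≡below : ∀ {n σ} → IsPerm n σ → filter (inBlock? 0 i) σ ≡ filter (_≤? i) σ
  firstBlock≡below p = filter-≐-local (inBlock? 0 i) (_≤? i) _ (λ a∈ → proj₂ , (proj₁ (IsPerm-bounds p a∈) ,_))

  range-above : ∀ m → All (i <_) (range (1 + i) m)
  range-above m = All.tabulate (λ y∈ → proj₁ (∈-range⁻ (1 + i) m y∈))

  filter-≤-range : ∀ m → filter (_≤? i) (range 1 (i + m)) ≡ range 1 i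
  filter-≤-range m = begin
    filter (_≤? i) (range 1 (i + m))                                ≡⟨ cong (filter (_≤? i)) (range-++ 1 i m) ⟩
    filter (_≤? i) (range 1 i ++ range (1 + i) m)                   ≡⟨ filter-++ (_≤? i) (range 1 i) _ ⟩
    filter (_≤? i) (range 1 i) ++ filter (_≤? i) (range (1 + i) m)  ≡⟨ cong₂ _++_ (filter-all (_≤? i) range-below)
                                                                         (filter-none (_≤? i) (All.map <⇒≱ (range-above m))) ⟩
    range 1 i ++ []                                                 ≡⟨ ++-identityʳ (range 1 i) ⟩
    range 1 i                                                       ∎
    where open ≡-Reasoning

  filter->-range : ∀ m → filter (i <?_) (range 1 (i + m)) ≡ range (1 + i) m
  filter->-range m = begin
    filter (i <?_) (range 1 (i + m))                                ≡⟨ cong (filter (i <?_)) (range-++ 1 i m) ⟩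
    filter (i <?_) (range 1 i ++ range (1 + i) m)                   ≡⟨ filter-++ (i <?_) (range 1 i) _ ⟩
    filter (i <?_) (range 1 i) ++ filter (i <?_) (range (1 + i) m)  ≡⟨ cong₂ _++_ (filter-none (i <?_) (All.map (λ y≤ i<y → <⇒≱ i<y y≤) range-below))
                                                                         (filter-all (i <?_) (range-above m)) ⟩
    range (1 + i) m                                                 ∎
    where open ≡-Reasoning

  shuffleMerges : List ℕ → List (List ℕ)
  shuffleMerges I = concatMap mergesWithBlock (shuffle I)

  shuffleMerges-unique : ∀ I → Unique (shuffleMerges I)
  shuffleMerges-unique I =
    Unique.concat⁺ (All.map⁺ (All.tabulate (λ τ∈ → merges-unique i _ _ range-below (map-+-above (∈shuffle⇒IsPerm I τ∈)))))
                   (AllPairs.map⁺ (Unique⇒AllPairs (shuffle-unique I) disjoint))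
    where
    disjoint : ∀ {τ₁ τ₂} → τ₁ ∈ shuffle I → τ₂ ∈ shuffle I →
               τ₁ ≢ τ₂ → Disjoint (mergesWithBlock τ₁) (mergesWithBlock τ₂)
    disjoint τ₁∈ τ₂∈ τ₁≢τ₂ (σ∈₁ , σ∈₂) = τ₁≢τ₂ (map-injective (+-cancelˡ-≡ i _ _)
      (trans (sym (proj₂ (∈mergesWithBlock⇒filters (∈shuffle⇒IsPerm I τ₁∈) σ∈₁)))
             (proj₂ (∈mergesWithBlock⇒filters (∈shuffle⇒IsPerm I τ₂∈) σ∈₂))))

  -- σ is its letters above i, shifted down by i, merged with the first block
  ∈shuffle-∷⇒∈shuffleMerges : ∀ I {σ} → σ ∈ shuffle (i ∷ I) → σ ∈ shuffleMerges I
  ∈shuffle-∷⇒∈shuffleMerges I {σ} σ∈ = ∈-concatMap⁺ mergesWithBlock (lose τ∈shuffle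
    (subst₂ (λ u v → σ ∈ merges u v) below≡ (sym map-+-τ) (filters⇒∈merges i σ)))
    where
    m = sum I
    pσ = ∈shuffle⇒IsPerm (i ∷ I) σ∈
    shσ = proj₂ (∈shuffle⁻ (i ∷ I) σ∈)
    below≡ : filter (_≤? i) σ ≡ range 1 i
    below≡ = ↗↭↗⇒≡ (subst (Linked _<_) (firstBlock≡below pσ) (proj₁ shσ)) (range-linked 1 i)
              (subst (filter (_≤? i) σ ↭_) (filter-≤-range m) (filter-↭ (_≤? i) pσ))
    τ = map (_∸ i) (filter (i <?_) σ)
    map-+-τ : map (i +_) τ ≡ filter (i <?_) σ
    map-+-τ = map-+-map-∸ i (All.tabulate (λ a∈ → <⇒≤ (proj₂ (∈-filter⁻ (i <?_) {xs = σ} a∈))))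
    pτ : IsPerm m τ
    pτ = subst (τ ↭_) (map-∸-range i 1 m) (map⁺ (_∸ i)
           (subst (filter (i <?_) σ ↭_) (trans (filter->-range m) (cong (λ z → range z m) (+-comm 1 i)))
                  (filter-↭ (i <?_) pσ)))
    τ∈shuffle : τ ∈ shuffle I
    τ∈shuffle = ∈shuffle⁺ I pτ
      (Equivalence.to (blocksIncreasing-shift I i 0 σ τ (sym (+-identityʳ i)) (sym map-+-τ)) (proj₂ shσ))

  ∈shuffleMerges⇒∈shuffle-∷ : ∀ I {σ} → σ ∈ shuffleMerges I → σ ∈ shuffle (i ∷ I)
  ∈shuffleMerges⇒∈shuffle-∷ I {σ} σ∈ with find (∈-concatMap⁻ mergesWithBlock {xs = shuffle I} σ∈)
  ... | τ , τ∈shuffle , σ∈m = ∈shuffle⁺ (i ∷ I) pσ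
    ( subst (Linked _<_) (sym (trans (firstBlock≡below pσ) (proj₁ filters))) (range-linked 1 i)
    , Equivalence.from (blocksIncreasing-shift I i 0 σ τ (sym (+-identityʳ i)) (proj₂ filters))
                       (proj₂ (∈shuffle⁻ I τ∈shuffle)))
    where
    pσ = ∈mergesWithBlock⇒IsPerm (∈shuffle⇒IsPerm I τ∈shuffle) σ∈m
    filters = ∈mergesWithBlock⇒filters (∈shuffle⇒IsPerm I τ∈shuffle) σ∈m

  shuffle-∷↭shuffleMerges : ∀ I → shuffle (i ∷ I) ↭ shuffleMerges I
  shuffle-∷↭shuffleMerges I =
    sameMembers⇒↭ (shuffle-unique (i ∷ I)) (shuffleMerges-unique I)
                  (∈shuffle-∷⇒∈shuffleMerges I) (∈shuffleMerges⇒∈shuffle-∷ I)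

Sc-merge : ∀ i m {τ σ} → IsPerm m τ → σ ∈ mergesWithBlock i τ → Sc σ ≡ map (scAt (i + m) σ) (range 1 i) ++ Sc τ
Sc-merge i m {τ} {σ} pτ σ∈ = begin
  Sc σ                                                           ≡⟨ Sc-≡ (∈mergesWithBlock⇒IsPerm i pτ σ∈) ⟩
  map (scAt (i + m) σ) (range 1 (i + m))                         ≡⟨ cong (map (scAt (i + m) σ)) (range-++ 1 i m) ⟩
  map (scAt (i + m) σ) (range 1 i ++ range (1 + i) m)            ≡⟨ map-++ (scAt (i + m) σ) (range 1 i) (range (1 + i) m) ⟩
  map (scAt (i + m) σ) (range 1 i) ++ map (scAt (i + m) σ) (range (1 + i) m)
                                                                 ≡⟨ cong (map (scAt (i + m) σ) (range 1 i) ++_) aboveCodes ⟩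
  map (scAt (i + m) σ) (range 1 i) ++ Sc τ                       ∎
  where
  open ≡-Reasoning
  aboveCodes : map (scAt (i + m) σ) (range (1 + i) m) ≡ Sc τ
  aboveCodes = begin
    map (scAt (i + m) σ) (range (1 + i) m)        ≡⟨ cong (λ k → map (scAt (i + m) σ) (range k m)) (+-comm 1 i) ⟩
    map (scAt (i + m) σ) (range (i + 1) m)        ≡⟨ cong (map (scAt (i + m) σ)) (map-+-range i 1 m) ⟨
    map (scAt (i + m) σ) (map (i +_) (range 1 m)) ≡⟨ map-∘ (range 1 m) ⟨
    map (scAt (i + m) σ ∘ (i +_)) (range 1 m)     ≡⟨ map-cong-local (All.tabulate (λ j∈ → scAt-shift i m σ τ _
                                                       (proj₁ (∈-range⁻ 1 m j∈)) (proj₂ (∈mergesWithBlock⇒filters i pτ σ∈)))) ⟩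
    map (scAt m τ) (range 1 m)                    ≡⟨ Sc-≡ pτ ⟨
    Sc τ                                          ∎

-- The inverse permutation

posOf-here : ∀ a w → posOf a (a ∷ w) ≡ 1
posOf-here a w rewrite dec-true (a ≟ a) refl = refl

posOf-there : ∀ {a c} w → a ≢ c → posOf a (c ∷ w) ≡ suc (posOf a w)
posOf-there {a} {c} w a≢c rewrite dec-false (a ≟ c) a≢c = refl

-- positions are 1-based; out-of-range positions give 0
letterAt : List ℕ → ℕ → ℕ
letterAt []      k             = 0
letterAt (a ∷ w) zero          = 0
letterAt (a ∷ w) (suc zero)    = a
letterAt (a ∷ w) (suc (suc k)) = letterAt w (suc k)

posOf-bounds : ∀ {v} w → v ∈ w → 1 ≤ posOf v w × posOf v w ≤ length w
posOf-bounds {v} (a ∷ w) v∈ with v ≟ a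
... | yes refl rewrite posOf-here v w = ≤-refl , s≤s z≤n
... | no v≢a with v∈
...   | here v≡a = ⊥-elim (v≢a v≡a)
...   | there v∈w rewrite posOf-there w v≢a = s≤s z≤n , s≤s (proj₂ (posOf-bounds w v∈w))

letterAt-posOf : ∀ {v} w → v ∈ w → letterAt w (posOf v w) ≡ v
letterAt-posOf {v} (a ∷ w) v∈ with v ≟ a
... | yes refl rewrite posOf-here v w = refl
... | no v≢a with v∈
...   | here v≡a = ⊥-elim (v≢a v≡a)
...   | there v∈w rewrite posOf-there w v≢a with posOf v w | posOf-bounds w v∈w | letterAt-posOf w v∈w
...     | suc k | _ | eq = eq

posOf-injective : ∀ {a b} w → a ∈ w → b ∈ w → posOf a w ≡ posOf b w → a ≡ b
posOf-injective w a∈ b∈ eq = trans (sym (letterAt-posOf w a∈)) (trans (cong (letterAt w) eq) (letterAt-posOf w b∈))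

letterAt-∈ : ∀ w k → 1 ≤ k → k ≤ length w → letterAt w k ∈ w
letterAt-∈ (a ∷ w) (suc zero)    _ _         = here refl
letterAt-∈ (a ∷ w) (suc (suc k)) _ (s≤s k≤) = there (letterAt-∈ w (suc k) (s≤s z≤n) k≤)

posOf-letterAt : ∀ w k → Unique w → 1 ≤ k → k ≤ length w → posOf (letterAt w k) w ≡ k
posOf-letterAt (a ∷ w) (suc zero)    _         _ _         = posOf-here a w
posOf-letterAt (a ∷ w) (suc (suc k)) (a∉ ∷ u) _ (s≤s k≤) =
  trans (posOf-there w (λ eq → All.lookup a∉ (letterAt-∈ w (suc k) (s≤s z≤n) k≤) (sym eq)))
        (cong suc (posOf-letterAt w (suc k) u (s≤s z≤n) k≤))

letterAt-map-range : ∀ (g : ℕ → ℕ) k n j → 1 ≤ j → j ≤ n → letterAt (map g (range k n)) j ≡ g (k + (j ∸ 1))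
letterAt-map-range g k (suc n) (suc zero)    _ _         = cong g (sym (+-identityʳ k))
letterAt-map-range g k (suc n) (suc (suc j)) _ (s≤s j≤) =
  trans (letterAt-map-range g (suc k) n (suc j) (s≤s z≤n) j≤) (cong g (sym (+-suc k j)))

map-letterAt : ∀ w → map (letterAt w) (range 1 (length w)) ≡ w
map-letterAt []      = refl
map-letterAt (a ∷ w) = cong (a ∷_) (begin
  map (letterAt (a ∷ w)) (range 2 (length w))         ≡⟨ cong (map (letterAt (a ∷ w))) (map-+-range 1 1 (length w)) ⟨
  map (letterAt (a ∷ w)) (map suc (range 1 (length w))) ≡⟨ map-∘ (range 1 (length w)) ⟨
  map (letterAt (a ∷ w) ∘ suc) (range 1 (length w))   ≡⟨ map-cong-local (All.tabulate (shift-letterAt ∘ proj₁ ∘ ∈-range⁻ 1 (length w))) ⟩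
  map (letterAt w) (range 1 (length w))               ≡⟨ map-letterAt w ⟩
  w                                                   ∎)
  where
  open ≡-Reasoning
  shift-letterAt : ∀ {j} → 1 ≤ j → letterAt (a ∷ w) (suc j) ≡ letterAt w j
  shift-letterAt {suc j} _ = refl

module _ {n σ} (p : IsPerm n σ) where

  inv-≡ : inv σ ≡ map (λ v → posOf v σ) (range 1 n)
  inv-≡ = trans (cong (λ l → map (λ v → posOf v σ) (oneTo l)) (IsPerm-length p))
                (cong (map (λ v → posOf v σ)) (oneTo-range n))

  inv-IsPerm : IsPerm n (inv σ)
  inv-IsPerm = subst (IsPerm n) (sym inv-≡)
    (IsPerm-intro n (trans (length-map _ (range 1 n)) (length-range 1 n)) (All.tabulate posOf∈range)
      (Unique-map⁺-local _ (range-unique 1 n) (λ a∈ b∈ → posOf-injective σ (∈σ a∈) (∈σ b∈))))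
    where
    ∈σ : ∀ {v} → v ∈ range 1 n → v ∈ σ
    ∈σ = ∈-resp-↭ (↭-sym p)
    posOf∈range : ∀ {y} → y ∈ map (λ v → posOf v σ) (range 1 n) → y ∈ range 1 n
    posOf∈range y∈ with v , v∈ , refl ← ∈-map⁻ _ y∈ with 1≤ , ≤len ← posOf-bounds σ (∈σ v∈) =
      ∈-range⁺ 1 n 1≤ (s≤s (subst (_ ≤_) (IsPerm-length p) ≤len))

inv-involutive : ∀ {n σ} → IsPerm n σ → inv (inv σ) ≡ σ
inv-involutive {n} {σ} p = begin
  inv τ                               ≡⟨ inv-≡ (inv-IsPerm p) ⟩
  map (λ k → posOf k τ) (range 1 n)   ≡⟨ map-cong-local (All.tabulate posOf-inv) ⟩
  map (letterAt σ) (range 1 n)        ≡⟨ cong (map (letterAt σ) ∘ range 1) (IsPerm-length p) ⟨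
  map (letterAt σ) (range 1 (length σ)) ≡⟨ map-letterAt σ ⟩
  σ                                   ∎
  where
  open ≡-Reasoning
  τ = inv σ
  posOf-inv : ∀ {k} → k ∈ range 1 n → posOf k τ ≡ letterAt σ k
  posOf-inv {k} k∈ = begin
    posOf k τ              ≡⟨ cong (λ z → posOf z τ) letterAt-τ ⟨
    posOf (letterAt τ j) τ ≡⟨ posOf-letterAt τ j (IsPerm-unique pτ) 1≤j (subst (j ≤_) (sym (IsPerm-length pτ)) j≤n) ⟩
    j                      ∎
    where
    pτ = inv-IsPerm p
    k-bounds = ∈-range⁻ 1 n k∈
    k≤len : k ≤ length σ
    k≤len = subst (k ≤_) (sym (IsPerm-length p)) (s≤s⁻¹ (proj₂ k-bounds))
    j = letterAt σ k
    j-bounds = IsPerm-bounds p (letterAt-∈ σ k (proj₁ k-bounds) k≤len)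
    1≤j = proj₁ j-bounds
    j≤n = s≤s⁻¹ (proj₂ j-bounds)
    letterAt-τ : letterAt τ j ≡ k
    letterAt-τ = begin
      letterAt τ j                                        ≡⟨ cong (λ l → letterAt l j) (inv-≡ p) ⟩
      letterAt (map (λ v → posOf v σ) (range 1 n)) j      ≡⟨ letterAt-map-range _ 1 n j 1≤j j≤n ⟩
      posOf (1 + (j ∸ 1)) σ                               ≡⟨ cong (λ z → posOf z σ) (m+[n∸m]≡n 1≤j) ⟩
      posOf j σ                                           ≡⟨ posOf-letterAt σ k (IsPerm-unique p) (proj₁ k-bounds) k≤len ⟩
      k                                                   ∎

map-inv-perms↭ : ∀ n → map inv (perms n) ↭ perms n
map-inv-perms↭ n = sameMembers⇒↭
  (Unique-map⁺-local inv (perms-unique n) (λ a∈ b∈ eq →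
     trans (sym (inv-involutive (∈perms⁻ n a∈))) (trans (cong inv eq) (inv-involutive (∈perms⁻ n b∈)))))
  (perms-unique n)
  (λ y∈ → let σ , σ∈ , y≡ = ∈-map⁻ inv y∈ in subst (_∈ perms n) (sym y≡) (inv-∈perms σ∈))
  (λ σ∈ → subst (_∈ map inv (perms n)) (inv-involutive (∈perms⁻ n σ∈)) (∈-map⁺ inv (inv-∈perms σ∈)))
  where
  inv-∈perms : ∀ {σ} → σ ∈ perms n → inv σ ∈ perms n
  inv-∈perms σ∈ = ∈perms⁺ n (inv-IsPerm (∈perms⁻ n σ∈))

-- Descents of the inverse permutation

descentsFrom-desc : ∀ k a b w → b < a → descentsFrom k (a ∷ b ∷ w) ≡ k ∷ descentsFrom (suc k) (b ∷ w)
descentsFrom-desc k a b w b<a rewrite dec-true (b <? a) b<a = refl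

descentsFrom-asc : ∀ k a b w → ¬ b < a → descentsFrom k (a ∷ b ∷ w) ≡ descentsFrom (suc k) (b ∷ w)
descentsFrom-asc k a b w b≮a rewrite dec-false (b <? a) b≮a = refl

DescentsSatisfy : (ℕ → Set) → (ℕ → ℕ) → ℕ → ℕ → Set
DescentsSatisfy P g k m = ∀ j → k ≤ j → suc j < k + m → g (suc j) < g j → P j

module _ (P : ℕ → Set) (g : ℕ → ℕ) where

  DescentsSatisfy-≤1 : ∀ k m → m ≤ 1 → DescentsSatisfy P g k m
  DescentsSatisfy-≤1 k m m≤1 j k≤j j+1<k+m _ =
    ⊥-elim (<⇒≱ (≤-<-trans k≤j (s≤s⁻¹ (<-≤-trans j+1<k+m (subst (k + m ≤_) (+-comm k 1) (+-monoʳ-≤ k m≤1))))) ≤-refl)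

  DescentsSatisfy-step : ∀ k m → DescentsSatisfy P g k (2 + m) ⇔
                         ((g (suc k) < g k → P k) × DescentsSatisfy P g (suc k) (suc m))
  DescentsSatisfy-step k m = mk⇔
    (λ d → d k ≤-refl k+1<k+m+2 , λ j k+1≤j lt → d j (≤-trans (n≤1+n k) k+1≤j) (subst (suc j <_) (sym (+-suc k (suc m))) lt))
    (λ (dk , ds) j k≤j lt → case-k dk ds j k≤j (subst (suc j <_) (+-suc k (suc m)) lt))
    where
    k+1<k+m+2 : suc k < k + (2 + m)
    k+1<k+m+2 = subst (suc k <_) (sym (trans (+-suc k (suc m)) (cong suc (+-suc k m)))) (s≤s (s≤s (m≤m+n k m)))
    case-k : (g (suc k) < g k → P k) → DescentsSatisfy P g (suc k) (suc m) →
             ∀ j → k ≤ j → suc j < suc k + suc m → g (suc j) < g j → P j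
    case-k dk ds j k≤j lt with k ≟ j
    ... | yes refl = dk
    ... | no k≢j   = ds j (≤∧≢⇒< k≤j k≢j) lt

  all-descents⇔DescentsSatisfy : ∀ k m → All P (descentsFrom k (map g (range k m))) ⇔ DescentsSatisfy P g k m
  all-descents⇔DescentsSatisfy k zero          = mk⇔ (λ _ → DescentsSatisfy-≤1 k 0 z≤n) (λ _ → [])
  all-descents⇔DescentsSatisfy k (suc zero)    = mk⇔ (λ _ → DescentsSatisfy-≤1 k 1 ≤-refl) (λ _ → [])
  all-descents⇔DescentsSatisfy k (suc (suc m)) =
    byCase (g (suc k) <? g k) (all-descents⇔DescentsSatisfy (suc k) (suc m))
    where
    step = DescentsSatisfy-step k m
    later = map g (range (suc (suc k)) m)
    byCase : Dec (g (suc k) < g k) →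
             All P (descentsFrom (suc k) (g (suc k) ∷ later)) ⇔ DescentsSatisfy P g (suc k) (suc m) →
             All P (descentsFrom k (g k ∷ g (suc k) ∷ later)) ⇔ DescentsSatisfy P g k (2 + m)
    byCase (yes desc) ih rewrite descentsFrom-desc k (g k) (g (suc k)) later desc = mk⇔
      (λ { (Pk ∷ rest) → Equivalence.from step ((λ _ → Pk) , Equivalence.to ih rest) })
      (λ d → proj₁ (Equivalence.to step d) desc ∷ Equivalence.from ih (proj₂ (Equivalence.to step d)))
    byCase (no asc) ih rewrite descentsFrom-asc k (g k) (g (suc k)) later asc = mk⇔
      (λ rest → Equivalence.from step ((⊥-elim ∘ asc) , Equivalence.to ih rest))
      (λ d → Equivalence.from ih (proj₂ (Equivalence.to step d)))

P-distinguishes : ∀ {P : Pred ℕ 0ℓ} {a c} → P a → ¬ P c → a ≢ c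
P-distinguishes Pa ¬Pc refl = ¬Pc Pa

posOf-filter-<⇔ : ∀ {P : Pred ℕ 0ℓ} (P? : Decidable P) σ {a b} → P a → P b → a ∈ σ → b ∈ σ →
                  posOf a (filter P? σ) < posOf b (filter P? σ) ⇔ posOf a σ < posOf b σ
posOf-filter-<⇔ P? (c ∷ σ) {a} {b} Pa Pb a∈ b∈ with P? c
... | no ¬Pc rewrite posOf-there {a} {c} σ (P-distinguishes Pa ¬Pc) | posOf-there {b} {c} σ (P-distinguishes Pb ¬Pc)
  with ih ← posOf-filter-<⇔ P? σ Pa Pb (∈-∷-≢⁻ a∈ (P-distinguishes Pa ¬Pc)) (∈-∷-≢⁻ b∈ (P-distinguishes Pb ¬Pc))
  = mk⇔ (s≤s ∘ Equivalence.to ih) (Equivalence.from ih ∘ s≤s⁻¹)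
... | yes Pc with a ≟ c | b ≟ c
...   | yes refl | yes refl rewrite posOf-here a (filter P? σ) | posOf-here a σ = mk⇔ id id
...   | yes refl | no b≢c rewrite posOf-here a (filter P? σ) | posOf-here a σ
                                | posOf-there (filter P? σ) b≢c | posOf-there σ b≢c =
  mk⇔ (λ _ → s≤s (proj₁ (posOf-bounds σ (∈-∷-≢⁻ b∈ b≢c))))
      (λ _ → s≤s (proj₁ (posOf-bounds (filter P? σ) (∈-filter⁺ P? (∈-∷-≢⁻ b∈ b≢c) Pb))))
...   | no a≢c | yes refl rewrite posOf-here b (filter P? σ) | posOf-here b σ
                                | posOf-there (filter P? σ) a≢c | posOf-there σ a≢c =
  mk⇔ (λ { (s≤s ()) }) (λ { (s≤s ()) })
...   | no a≢c | no b≢c rewrite posOf-there (filter P? σ) a≢c | posOf-there σ a≢c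
                              | posOf-there (filter P? σ) b≢c | posOf-there σ b≢c
  with ih ← posOf-filter-<⇔ P? σ Pa Pb (∈-∷-≢⁻ a∈ a≢c) (∈-∷-≢⁻ b∈ b≢c)
  = mk⇔ (s≤s ∘ Equivalence.to ih ∘ s≤s⁻¹) (s≤s ∘ Equivalence.from ih ∘ s≤s⁻¹)

posOf-range-< : ∀ a k j → a ≤ j → suc j < a + k → posOf j (range a k) < posOf (suc j) (range a k)
posOf-range-< a zero j a≤j j+1<a =
  ⊥-elim (<-irrefl refl (≤-<-trans a≤j (<-trans (n<1+n j) (subst (suc j <_) (+-identityʳ a) j+1<a))))
posOf-range-< a (suc k) j a≤j j+1<a+k+1 with a ≟ j
... | yes refl rewrite posOf-here a (range (suc a) k) | posOf-there {suc a} {a} (range (suc a) k) (λ eq → <-irrefl (sym eq) (n<1+n a)) =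
  s≤s (proj₁ (posOf-bounds (range (suc a) k) (∈-range⁺ (suc a) k ≤-refl (subst (suc a <_) (+-suc a k) j+1<a+k+1))))
... | no a≢j rewrite posOf-there {j} {a} (range (suc a) k) (a≢j ∘ sym)
                   | posOf-there {suc j} {a} (range (suc a) k) (λ eq → <-irrefl (sym eq) (s≤s a≤j)) =
  s≤s (posOf-range-< (suc a) k j (≤∧≢⇒< a≤j a≢j) (subst (suc j <_) (+-suc a k) j+1<a+k+1))

↭range-ordered⇒≡range : ∀ a k f → f ↭ range a k →
  (∀ j → a ≤ j → suc j < a + k → posOf j f < posOf (suc j) f) → f ≡ range a k
↭range-ordered⇒≡range a zero    f       p _ = ↭-empty-inv p
↭range-ordered⇒≡range a (suc k) []      p _ with () ← ∈-resp-↭ (↭-sym p) (here refl)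
↭range-ordered⇒≡range a (suc k) (x ∷ f) p ordered with x ≟ a
... | yes refl = cong (x ∷_) (↭range-ordered⇒≡range (suc a) k f (drop-∷ p) ordered-f)
  where
  ordered-f : ∀ j → suc a ≤ j → suc j < suc a + k → posOf j f < posOf (suc j) f
  ordered-f j a<j lt with ordered j (<⇒≤ a<j) (subst (suc j <_) (sym (+-suc a k)) lt)
  ... | r rewrite posOf-there {j} {a} f (λ eq → <-irrefl (sym eq) a<j)
                | posOf-there {suc j} {a} f (λ eq → <-irrefl (sym eq) (m<n⇒m<1+n a<j)) = s≤s⁻¹ r
... | no x≢a with ∈-range⁻ a (suc k) (∈-resp-↭ p (here refl))
... | a≤x , x<a+k+1 with x
...   | zero  = ⊥-elim (x≢a (sym (n≤0⇒n≡0 a≤x)))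
-- the letter y just below the head x = y + 1 would have to occur before position 1
...   | suc y = ⊥-elim (<-irrefl refl (≤-trans y-first (proj₁ (posOf-bounds (suc y ∷ f) y∈))))
  where
  a≤y : a ≤ y
  a≤y = s≤s⁻¹ (≤∧≢⇒< a≤x (x≢a ∘ sym))
  y∈ : y ∈ suc y ∷ f
  y∈ = ∈-resp-↭ (↭-sym p) (∈-range⁺ a (suc k) a≤y (<-trans (n<1+n y) x<a+k+1))
  y-first : posOf y (suc y ∷ f) < 1
  y-first = subst (posOf y (suc y ∷ f) <_) (posOf-here (suc y) f) (ordered y a≤y x<a+k+1)

ConsecutiveInOrder : ℕ → ℕ → List ℕ → Set
ConsecutiveInOrder s i σ = ∀ j → s < j → suc j ≤ s + i → posOf j σ < posOf (suc j) σ

block-increasing⇔ConsecutiveInOrder : ∀ s i σ → Unique σ → (∀ a → s < a → a ≤ s + i → a ∈ σ) →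
  Linked _<_ (filter (inBlock? s i) σ) ⇔ ConsecutiveInOrder s i σ
block-increasing⇔ConsecutiveInOrder s i σ u block⊆σ = mk⇔
  (λ lk j s<j j+1≤ → Equivalence.to (filter-order j s<j j+1≤)
     (subst (λ l → posOf j l < posOf (suc j) l) (sym (↗↭↗⇒≡ lk (range-linked (suc s) i) block↭range))
            (posOf-range-< (suc s) i j s<j (s≤s j+1≤))))
  (λ ordered → subst (Linked _<_) (sym (↭range-ordered⇒≡range (suc s) i block block↭range
     (λ j s<j j+1< → Equivalence.from (filter-order j s<j (s≤s⁻¹ j+1<)) (ordered j s<j (s≤s⁻¹ j+1<)))))
     (range-linked (suc s) i))
  where
  block = filter (inBlock? s i) σ
  block↭range : block ↭ range (suc s) i
  block↭range = sameMembers⇒↭ (Unique.filter⁺ (inBlock? s i) u) (range-unique (suc s) i)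
    (λ z∈ → let s<z , z≤ = proj₂ (∈-filter⁻ (inBlock? s i) {xs = σ} z∈) in ∈-range⁺ (suc s) i s<z (s≤s z≤))
    (λ z∈ → let s<z , z< = ∈-range⁻ (suc s) i z∈ in ∈-filter⁺ (inBlock? s i) (block⊆σ _ s<z (s≤s⁻¹ z<)) (s<z , s≤s⁻¹ z<))
  filter-order : ∀ j → s < j → suc j ≤ s + i →
                 posOf j block < posOf (suc j) block ⇔ posOf j σ < posOf (suc j) σ
  filter-order j s<j j+1≤ = posOf-filter-<⇔ (inBlock? s i) σ (s<j , <⇒≤ j+1≤) (<-trans s<j (n<1+n j) , j+1≤)
    (block⊆σ j s<j (<⇒≤ j+1≤)) (block⊆σ (suc j) (<-trans s<j (n<1+n j)) j+1≤)

properPartialSumsFrom-≥ : ∀ t I {j} → j ∈ properPartialSumsFrom t I → t ≤ j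
properPartialSumsFrom-≥ t (i ∷ i′ ∷ I) (here refl) = m≤m+n t i
properPartialSumsFrom-≥ t (i ∷ i′ ∷ I) (there j∈)  = ≤-trans (m≤m+n t i) (properPartialSumsFrom-≥ (t + i) (i′ ∷ I) j∈)

OrderedOffBoundaries : ℕ → List ℕ → List ℕ → Set
OrderedOffBoundaries s I σ = ∀ j → s < j → suc j ≤ s + sum I → j ∉ properPartialSumsFrom s I → posOf j σ < posOf (suc j) σ

blocksIncreasing⇔OrderedOffBoundaries : ∀ I s σ → Unique σ → (∀ a → s < a → a ≤ s + sum I → a ∈ σ) →
  BlocksIncreasingFrom s I σ ⇔ OrderedOffBoundaries s I σ
blocksIncreasing⇔OrderedOffBoundaries [] s σ u _ =
  mk⇔ (λ _ j s<j j<s+0 _ → ⊥-elim (<-asym s<j (subst (j <_) (+-identityʳ s) j<s+0))) (λ _ → tt)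
blocksIncreasing⇔OrderedOffBoundaries (i ∷ []) s σ u block⊆σ = mk⇔
  (λ (lk , _) j s<j le _ → Equivalence.to first lk j s<j (subst (suc j ≤_) s+i+0≡ le))
  (λ ordered → Equivalence.from first (λ j s<j le → ordered j s<j (subst (suc j ≤_) (sym s+i+0≡) le) (λ ())) , tt)
  where
  s+i+0≡ = cong (s +_) (+-identityʳ i)
  first = block-increasing⇔ConsecutiveInOrder s i σ u (λ a s<a le → block⊆σ a s<a (subst (a ≤_) (sym s+i+0≡) le))
blocksIncreasing⇔OrderedOffBoundaries (i ∷ i′ ∷ I) s σ u block⊆σ =
  withRest (blocksIncreasing⇔OrderedOffBoundaries (i′ ∷ I) (s + i) σ u
              (λ a s+i<a le → block⊆σ a (≤-<-trans (m≤m+n s i) s+i<a) (subst (a ≤_) (+-assoc s i (sum (i′ ∷ I))) le)))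
  where
  S = sum (i′ ∷ I)
  first = block-increasing⇔ConsecutiveInOrder s i σ u (λ a s<a le → block⊆σ a s<a (≤-trans le (+-monoʳ-≤ s (m≤m+n i S))))
  withRest : BlocksIncreasingFrom (s + i) (i′ ∷ I) σ ⇔ OrderedOffBoundaries (s + i) (i′ ∷ I) σ →
             BlocksIncreasingFrom s (i ∷ i′ ∷ I) σ ⇔ OrderedOffBoundaries s (i ∷ i′ ∷ I) σ
  withRest rest = mk⇔ to from
    where
    to : BlocksIncreasingFrom s (i ∷ i′ ∷ I) σ → OrderedOffBoundaries s (i ∷ i′ ∷ I) σ
    to (lk , lks) j s<j le j∉ with suc j ≤? s + i
    ... | yes inFirst = Equivalence.to first lk j s<j inFirst
    ... | no ¬inFirst = Equivalence.to rest lks j s+i<j (subst (suc j ≤_) (sym (+-assoc s i S)) le) (j∉ ∘ there)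
      where
      s+i<j : s + i < j
      s+i<j = ≤∧≢⇒< (s≤s⁻¹ (≰⇒> ¬inFirst)) (λ s+i≡j → j∉ (here (sym s+i≡j)))
    from : OrderedOffBoundaries s (i ∷ i′ ∷ I) σ → BlocksIncreasingFrom s (i ∷ i′ ∷ I) σ
    from ordered =
      Equivalence.from first (λ j s<j le → ordered j s<j (≤-trans le (+-monoʳ-≤ s (m≤m+n i S))) (notBoundary j le)) ,
      Equivalence.from rest (λ j s+i<j le j∉ → ordered j (≤-<-trans (m≤m+n s i) s+i<j) (subst (suc j ≤_) (+-assoc s i S) le)
                                                 (λ { (here j≡) → <-irrefl (sym j≡) s+i<j ; (there j∈) → j∉ j∈ }))
      where
      notBoundary : ∀ j → suc j ≤ s + i → j ∉ properPartialSumsFrom s (i ∷ i′ ∷ I)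
      notBoundary j le (here j≡)  = <-irrefl j≡ le
      notBoundary j le (there j∈) = <-irrefl refl (<-≤-trans le (properPartialSumsFrom-≥ (s + i) (i′ ∷ I) j∈))

inDLeq-inv⇔inShuffle : ∀ I σ → IsPerm (sum I) σ → InDLeq I (inv σ) ⇔ InShuffle I σ
inDLeq-inv⇔inShuffle I σ p = mk⇔
  (λ d → Equivalence.from blocks⇔ (descents⇒ordered
            (Equivalence.to descents⇔ (subst (All Boundary ∘ descents) (inv-≡ p) d))))
  (λ sh → subst (All Boundary ∘ descents) (sym (inv-≡ p))
            (Equivalence.from descents⇔ (ordered⇒descents (Equivalence.to blocks⇔ sh))))
  where
  N = sum I
  g = λ v → posOf v σ
  Boundary = λ j → j ∈ properPartialSums I
  ∈σ : ∀ a → 0 < a → a ≤ 0 + N → a ∈ σ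
  ∈σ a 0<a a≤N = ∈-resp-↭ (↭-sym p) (∈-range⁺ 1 N 0<a (s≤s a≤N))
  blocks⇔ = blocksIncreasing⇔OrderedOffBoundaries I 0 σ (IsPerm-unique p) ∈σ
  descents⇔ = all-descents⇔DescentsSatisfy Boundary g 1 N
  ordered⇒descents : OrderedOffBoundaries 0 I σ → DescentsSatisfy Boundary g 1 N
  ordered⇒descents ordered j 1≤j lt desc with j ∈? properPartialSums I
  ... | yes j∈ = j∈
  ... | no j∉  = ⊥-elim (<-asym desc (ordered j 1≤j (s≤s⁻¹ lt) j∉))
  descents⇒ordered : DescentsSatisfy Boundary g 1 N → OrderedOffBoundaries 0 I σ
  descents⇒ordered descentsOk j 0<j le j∉ with <-cmp (g j) (g (suc j))
  ... | tri< lt _ _ = lt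
  ... | tri≈ _ eq _ = ⊥-elim (<-irrefl (posOf-injective σ (∈σ j 0<j (<⇒≤ le)) (∈σ (suc j) (<-trans 0<j (n<1+n j)) le) eq) (n<1+n j))
  ... | tri> _ _ gt = ⊥-elim (j∉ (descentsOk j 0<j (s≤s le) gt))

module Evaluation {r ℓ : Level} (R : CommutativeSemiring r ℓ) (x : ℕ → CommutativeSemiring.Carrier R) where

  open Poly R x
  open CommutativeSemiring R
    using (Carrier; 0#; 1#; _≈_; +-cong; +-congˡ; +-congʳ; *-congˡ; *-congʳ;
           zeroˡ; zeroʳ; distribˡ; distribʳ)
    renaming (_+_ to _⊕_; _*_ to _⊗_; setoid to ≈-setoid;
              refl to ≈-refl; sym to ≈-sym; trans to ≈-trans; reflexive to ≈-reflexive;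
              +-assoc to ⊕-assoc; +-comm to ⊕-comm; +-identityˡ to ⊕-identityˡ; +-identityʳ to ⊕-identityʳ;
              *-assoc to ⊗-assoc; *-identityˡ to ⊗-identityˡ)
  open import Relation.Binary.Reasoning.Setoid ≈-setoid
  open import Algebra.Solver.Ring.NaturalCoefficients.Default R using (solve; _:+_; _:*_; _:=_; con)

  Σ-↭ : ∀ {A : Set} {xs ys : List A} (f : A → Carrier) → xs ↭ ys → Σ[ xs ] f ≈ Σ[ ys ] f
  Σ-↭ f ↭.refl             = ≈-refl
  Σ-↭ f (↭.prep a p)       = +-congˡ (Σ-↭ f p)
  Σ-↭ {xs = a ∷ b ∷ xs} {b ∷ a ∷ ys} f (↭.swap a b p) = begin
    f a ⊕ (f b ⊕ Σ[ xs ] f) ≈⟨ ⊕-assoc _ _ _ ⟨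
    (f a ⊕ f b) ⊕ Σ[ xs ] f ≈⟨ +-cong (⊕-comm _ _) (Σ-↭ f p) ⟩
    (f b ⊕ f a) ⊕ Σ[ ys ] f ≈⟨ ⊕-assoc _ _ _ ⟩
    f b ⊕ (f a ⊕ Σ[ ys ] f) ∎
  Σ-↭ f (↭.trans p q)      = ≈-trans (Σ-↭ f p) (Σ-↭ f q)

  Σ-cong-local : ∀ {A : Set} (xs : List A) {f g : A → Carrier} → (∀ {z} → z ∈ xs → f z ≈ g z) →
                 Σ[ xs ] f ≈ Σ[ xs ] g
  Σ-cong-local []       f≈g = ≈-refl
  Σ-cong-local (a ∷ xs) f≈g = +-cong (f≈g (here refl)) (Σ-cong-local xs (f≈g ∘ there))

  Σ-filter : ∀ {A : Set} {P : Pred A 0ℓ} (P? : Decidable P) (xs : List A) (f : A → Carrier) →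
             Σ[ filter P? xs ] f ≈ Σ[ xs ] (λ z → if does (P? z) then f z else 0#)
  Σ-filter P? []       f = ≈-refl
  Σ-filter P? (a ∷ xs) f with does (P? a)
  ... | true  = +-congˡ (Σ-filter P? xs f)
  ... | false = ≈-trans (Σ-filter P? xs f) (≈-sym (⊕-identityˡ _))

  Σ-map : ∀ {A B : Set} (φ : A → B) (xs : List A) (g : B → Carrier) → Σ[ map φ xs ] g ≡ Σ[ xs ] (g ∘ φ)
  Σ-map φ []       g = refl
  Σ-map φ (a ∷ xs) g = cong (g (φ a) ⊕_) (Σ-map φ xs g)

  Σ-++ : ∀ {A : Set} (xs ys : List A) (f : A → Carrier) → Σ[ xs ++ ys ] f ≈ Σ[ xs ] f ⊕ Σ[ ys ] f
  Σ-++ []       ys f = ≈-sym (⊕-identityˡ _)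
  Σ-++ (a ∷ xs) ys f = ≈-trans (+-congˡ (Σ-++ xs ys f)) (≈-sym (⊕-assoc _ _ _))

  Σ-concatMap : ∀ {A B : Set} (h : A → List B) (xs : List A) (f : B → Carrier) →
                Σ[ concatMap h xs ] f ≈ Σ[ xs ] (λ a → Σ[ h a ] f)
  Σ-concatMap h []       f = ≈-refl
  Σ-concatMap h (a ∷ xs) f = ≈-trans (Σ-++ (h a) (concatMap h xs) f) (+-congˡ (Σ-concatMap h xs f))

  Σ-*ʳ : ∀ {A : Set} (xs : List A) (f : A → Carrier) (k : Carrier) → Σ[ xs ] (λ a → f a ⊗ k) ≈ Σ[ xs ] f ⊗ k
  Σ-*ʳ []       f k = ≈-sym (zeroˡ k)
  Σ-*ʳ (a ∷ xs) f k = ≈-trans (+-congˡ (Σ-*ʳ xs f k)) (≈-sym (distribʳ k (f a) _))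

  Σ-*ˡ : ∀ {A : Set} (xs : List A) (f : A → Carrier) (k : Carrier) → Σ[ xs ] (λ a → k ⊗ f a) ≈ k ⊗ Σ[ xs ] f
  Σ-*ˡ []       f k = ≈-sym (zeroʳ k)
  Σ-*ˡ (a ∷ xs) f k = ≈-trans (+-congˡ (Σ-*ˡ xs f k)) (≈-sym (distribˡ k (f a) _))

  mono-++ : ∀ (u v : List ℕ) → mono (u ++ v) ≈ mono u ⊗ mono v
  mono-++ []      v = ≈-sym (⊗-identityˡ _)
  mono-++ (a ∷ u) v = ≈-trans (*-congˡ (mono-++ u v)) (≈-sym (⊗-assoc _ _ _))

  -- h_k of the variables x_c, c ∈ L (with multiplicity)
  hOn : ℕ → List ℕ → Carrier
  hOn zero    L       = 1#
  hOn (suc k) []      = 0#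
  hOn (suc k) (c ∷ L) = x c ⊗ hOn k (c ∷ L) ⊕ hOn (suc k) L

  hOn-prep : ∀ c {L L′} → (∀ k → hOn k L ≈ hOn k L′) → ∀ k → hOn k (c ∷ L) ≈ hOn k (c ∷ L′)
  hOn-prep c L≈L′ zero    = ≈-refl
  hOn-prep c L≈L′ (suc k) = +-cong (*-congˡ (hOn-prep c L≈L′ k)) (L≈L′ (suc k))

  hOn-swap : ∀ a b L k → hOn k (a ∷ b ∷ L) ≈ hOn k (b ∷ a ∷ L)
  hOn-swap a b L zero    = ≈-refl
  hOn-swap a b L (suc k) = begin
    x a ⊗ A k ⊕ hOn (suc k) (b ∷ L) ≈⟨ exchange k ⟩
    x b ⊗ A k ⊕ hOn (suc k) (a ∷ L) ≈⟨ +-congʳ (*-congˡ (hOn-swap a b L k)) ⟩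
    x b ⊗ hOn k (b ∷ a ∷ L) ⊕ hOn (suc k) (a ∷ L) ∎
    where
    A = λ k → hOn k (a ∷ b ∷ L)
    exchange : ∀ k → x a ⊗ A k ⊕ hOn (suc k) (b ∷ L) ≈ x b ⊗ A k ⊕ hOn (suc k) (a ∷ L)
    exchange zero = solve 3 (λ p q r → p :* con 1 :+ (q :* con 1 :+ r) := q :* con 1 :+ (p :* con 1 :+ r))
                      ≈-refl (x a) (x b) (hOn 1 L)
    exchange (suc k) = begin
      x a ⊗ (x a ⊗ A k ⊕ hOn (suc k) (b ∷ L)) ⊕ (x b ⊗ hOn (suc k) (b ∷ L) ⊕ hOn (2 + k) L)
        ≈⟨ +-congʳ (*-congˡ (exchange k)) ⟩
      x a ⊗ (x b ⊗ A k ⊕ hOn (suc k) (a ∷ L)) ⊕ (x b ⊗ hOn (suc k) (b ∷ L) ⊕ hOn (2 + k) L)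
        ≈⟨ solve 6 (λ p q α e f r → p :* (q :* α :+ e) :+ (q :* f :+ r) := q :* (p :* α :+ f) :+ (p :* e :+ r))
             ≈-refl (x a) (x b) (A k) (hOn (suc k) (a ∷ L)) (hOn (suc k) (b ∷ L)) (hOn (2 + k) L) ⟩
      x b ⊗ (x a ⊗ A k ⊕ hOn (suc k) (b ∷ L)) ⊕ (x a ⊗ hOn (suc k) (a ∷ L) ⊕ hOn (2 + k) L) ∎

  hOn-↭ : ∀ {L L′} → L ↭ L′ → ∀ k → hOn k L ≈ hOn k L′
  hOn-↭ ↭.refl          k = ≈-refl
  hOn-↭ (↭.prep c p)      = hOn-prep c (hOn-↭ p)
  hOn-↭ {a ∷ b ∷ L} (↭.swap a b p) k = ≈-trans (hOn-swap a b L k) (hOn-prep b (hOn-prep a (hOn-↭ p)) k)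
  hOn-↭ (↭.trans p q)   k = ≈-trans (hOn-↭ p k) (hOn-↭ q k)

  Σ-nondecreasingWords : ∀ k L → Σ[ nondecreasingWords k L ] mono ≈ hOn k L
  Σ-nondecreasingWords zero    L       = ⊕-identityʳ 1#
  Σ-nondecreasingWords (suc k) []      = ≈-refl
  Σ-nondecreasingWords (suc k) (c ∷ L) = begin
    Σ[ map (c ∷_) (nondecreasingWords k (c ∷ L)) ++ nondecreasingWords (suc k) L ] mono
      ≈⟨ Σ-++ (map (c ∷_) (nondecreasingWords k (c ∷ L))) _ mono ⟩
    Σ[ map (c ∷_) (nondecreasingWords k (c ∷ L)) ] mono ⊕ Σ[ nondecreasingWords (suc k) L ] mono
      ≈⟨ +-cong (≈-reflexive (Σ-map (c ∷_) (nondecreasingWords k (c ∷ L)) mono)) (Σ-nondecreasingWords (suc k) L) ⟩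
    Σ[ nondecreasingWords k (c ∷ L) ] (λ w → x c ⊗ mono w) ⊕ hOn (suc k) L
      ≈⟨ +-congʳ (Σ-*ˡ (nondecreasingWords k (c ∷ L)) mono (x c)) ⟩
    x c ⊗ Σ[ nondecreasingWords k (c ∷ L) ] mono ⊕ hOn (suc k) L
      ≈⟨ +-congʳ (*-congˡ (Σ-nondecreasingWords k (c ∷ L))) ⟩
    x c ⊗ hOn k (c ∷ L) ⊕ hOn (suc k) L ∎

  h≈hOn-range : ∀ k m → h k m ≈ hOn k (range 0 (suc m))
  h≈hOn-range k m = begin
    h k m                                          ≈⟨ Σ-↭ mono (nondecreasing-words↭nondecreasingWords k m) ⟩
    Σ[ nondecreasingWords k (upTo (suc m)) ] mono  ≈⟨ Σ-nondecreasingWords k (upTo (suc m)) ⟩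
    hOn k (upTo (suc m))                           ≡⟨ cong (hOn k) (upTo-range (suc m)) ⟩
    hOn k (range 0 (suc m))                        ∎

  module _ (i n : ℕ) where

    codesProduct : ℕ → ℕ → List ℕ → List ℕ → Carrier
    codesProduct a k p w = mono (map (scAt n (p ++ w)) (range a k))

    codesProduct-below : ∀ k a p (ws : List (List ℕ)) → a ≤ i → Separated i a p →
      Σ[ map (a ∷_) ws ] (codesProduct a (suc k) p) ≈ x (lastAboveCode i n p) ⊗ Σ[ ws ] (codesProduct (suc a) k (p ++ a ∷ []))
    codesProduct-below k a p ws a≤i sep = begin
      Σ[ map (a ∷_) ws ] (codesProduct a (suc k) p)
        ≡⟨ Σ-map (a ∷_) ws (codesProduct a (suc k) p) ⟩
      Σ[ ws ] (λ w → x (scAt n (p ++ a ∷ w) a) ⊗ mono (map (scAt n (p ++ a ∷ w)) (range (suc a) k)))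
        ≈⟨ Σ-cong-local ws (λ {w} _ → ≈-reflexive (cong₂ (λ c q → x c ⊗ mono (map (scAt n q) (range (suc a) k)))
             (scAt-below i n a p w a≤i sep) (sym (++-assoc p (a ∷ []) w)))) ⟩
      Σ[ ws ] (λ w → x (lastAboveCode i n p) ⊗ codesProduct (suc a) k (p ++ a ∷ []) w)
        ≈⟨ Σ-*ˡ ws _ _ ⟩
      x (lastAboveCode i n p) ⊗ Σ[ ws ] (codesProduct (suc a) k (p ++ a ∷ [])) ∎

    codesProduct-above : ∀ k a p b (ws : List (List ℕ)) →
      Σ[ map (b ∷_) ws ] (codesProduct a k p) ≈ Σ[ ws ] (codesProduct a k (p ++ b ∷ []))
    codesProduct-above k a p b ws = begin
      Σ[ map (b ∷_) ws ] (codesProduct a k p)     ≡⟨ Σ-map (b ∷_) ws (codesProduct a k p) ⟩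
      Σ[ ws ] (λ w → codesProduct a k p (b ∷ w))  ≈⟨ Σ-cong-local ws (λ {w} _ → ≈-reflexive
                                                       (cong (λ q → mono (map (scAt n q) (range a k))) (sym (++-assoc p (b ∷ []) w)))) ⟩
      Σ[ ws ] (codesProduct a k (p ++ b ∷ []))    ∎

    private
      a+1+k≤ : ∀ k a → a + suc k ≤ suc i → suc a + k ≤ suc i
      a+1+k≤ k a = subst (_≤ suc i) (+-suc a k)
      a≤i : ∀ k a → a + suc k ≤ suc i → a ≤ i
      a≤i k a le = s≤s⁻¹ (≤-trans (m≤m+n (suc a) k) (a+1+k≤ k a le))

    -- Each letter ≤ i contributes the code of the last letter > i before it;
    -- summing over interleavings gives the recursion defining hOn.
    Σ-merges-codesProduct : ∀ k a v p → a + k ≤ suc i → Separated i a p → All (i <_) v →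
      Σ[ merges (range a k) v ] (codesProduct a k p) ≈ hOn k (lastAboveCode i n p ∷ map (suc n ∸_) v)
    Σ-merges-codesProduct zero    a v       p _  _   _            = ⊕-identityʳ 1#
    Σ-merges-codesProduct (suc k) a []      p le sep _            = begin
      Σ[ map (a ∷_) (range (suc a) k ∷ []) ] (codesProduct a (suc k) p)
        ≈⟨ codesProduct-below k a p (range (suc a) k ∷ []) (a≤i k a le) sep ⟩
      x c ⊗ Σ[ range (suc a) k ∷ [] ] (codesProduct (suc a) k (p ++ a ∷ []))
        ≡⟨ cong (λ ws → x c ⊗ Σ[ ws ] (codesProduct (suc a) k (p ++ a ∷ []))) (sym (merges-[] (range (suc a) k))) ⟩
      x c ⊗ Σ[ merges (range (suc a) k) [] ] (codesProduct (suc a) k (p ++ a ∷ []))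
        ≈⟨ *-congˡ (Σ-merges-codesProduct k (suc a) [] (p ++ a ∷ []) (a+1+k≤ k a le) (Separated-∷ʳ-below i a p sep) []) ⟩
      x c ⊗ hOn k (lastAboveCode i n (p ++ a ∷ []) ∷ [])
        ≡⟨ cong (λ c′ → x c ⊗ hOn k (c′ ∷ [])) (lastAboveCode-∷ʳ-below i n p a (a≤i k a le)) ⟩
      x c ⊗ hOn k (c ∷ [])
        ≈⟨ ⊕-identityʳ _ ⟨
      hOn (suc k) (c ∷ []) ∎
      where c = lastAboveCode i n p
    Σ-merges-codesProduct (suc k) a (b ∷ v) p le sep (i<b ∷ v>i) = begin
      Σ[ map (a ∷_) (merges (range (suc a) k) (b ∷ v)) ++ map (b ∷_) (merges (range a (suc k)) v) ] (codesProduct a (suc k) p)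
        ≈⟨ Σ-++ (map (a ∷_) (merges (range (suc a) k) (b ∷ v))) _ _ ⟩
      Σ[ map (a ∷_) (merges (range (suc a) k) (b ∷ v)) ] (codesProduct a (suc k) p)
        ⊕ Σ[ map (b ∷_) (merges (range a (suc k)) v) ] (codesProduct a (suc k) p)
        ≈⟨ +-cong (codesProduct-below k a p (merges (range (suc a) k) (b ∷ v)) (a≤i k a le) sep)
                  (codesProduct-above (suc k) a p b (merges (range a (suc k)) v)) ⟩
      x c ⊗ Σ[ merges (range (suc a) k) (b ∷ v) ] (codesProduct (suc a) k (p ++ a ∷ []))
        ⊕ Σ[ merges (range a (suc k)) v ] (codesProduct a (suc k) (p ++ b ∷ []))
        ≈⟨ +-cong (*-congˡ (Σ-merges-codesProduct k (suc a) (b ∷ v) (p ++ a ∷ []) (a+1+k≤ k a le)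
                                                  (Separated-∷ʳ-below i a p sep) (i<b ∷ v>i)))
                  (Σ-merges-codesProduct (suc k) a v (p ++ b ∷ []) le (Separated-∷ʳ-above i a p b i<b sep) v>i) ⟩
      x c ⊗ hOn k (lastAboveCode i n (p ++ a ∷ []) ∷ map (suc n ∸_) (b ∷ v))
        ⊕ hOn (suc k) (lastAboveCode i n (p ++ b ∷ []) ∷ map (suc n ∸_) v)
        ≡⟨ cong₂ (λ c′ c″ → x c ⊗ hOn k (c′ ∷ map (suc n ∸_) (b ∷ v)) ⊕ hOn (suc k) (c″ ∷ map (suc n ∸_) v))
             (lastAboveCode-∷ʳ-below i n p a (a≤i k a le)) (lastAboveCode-∷ʳ-above i n p b i<b) ⟩
      hOn (suc k) (c ∷ map (suc n ∸_) (b ∷ v)) ∎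
      where c = lastAboveCode i n p

  module _ (i m : ℕ) {τ} (pτ : IsPerm m τ) where

    Σ-mergesWithBlock : Σ[ mergesWithBlock i τ ] (mono ∘ Sc) ≈ h i m ⊗ mono (Sc τ)
    Σ-mergesWithBlock = begin
      Σ[ M ] (mono ∘ Sc)
        ≈⟨ Σ-cong-local M (λ {σ} σ∈ → ≈-trans (≈-reflexive (cong mono (Sc-merge i m pτ σ∈)))
                                               (mono-++ (map (scAt (i + m) σ) (range 1 i)) (Sc τ))) ⟩
      Σ[ M ] (λ σ → codesProduct i (i + m) 1 i [] σ ⊗ mono (Sc τ))
        ≈⟨ Σ-*ʳ M (codesProduct i (i + m) 1 i []) (mono (Sc τ)) ⟩
      Σ[ M ] (codesProduct i (i + m) 1 i []) ⊗ mono (Sc τ)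
        ≈⟨ *-congʳ (Σ-merges-codesProduct i (i + m) i 1 (map (i +_) τ) [] ≤-refl [] (map-+-above i pτ)) ⟩
      hOn i (0 ∷ map (suc (i + m) ∸_) (map (i +_) τ)) ⊗ mono (Sc τ)
        ≡⟨ cong (λ l → hOn i (0 ∷ l) ⊗ mono (Sc τ)) codes-above ⟩
      hOn i (0 ∷ map (suc m ∸_) τ) ⊗ mono (Sc τ)
        ≈⟨ *-congʳ (hOn-↭ (↭-prep 0 (↭-trans (map⁺ (suc m ∸_) pτ) (complement-range↭ m))) i) ⟩
      hOn i (range 0 (suc m)) ⊗ mono (Sc τ)
        ≈⟨ *-congʳ (h≈hOn-range i m) ⟨
      h i m ⊗ mono (Sc τ) ∎
      where
      M = mergesWithBlock i τ
      codes-above : map (suc (i + m) ∸_) (map (i +_) τ) ≡ map (suc m ∸_) τ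
      codes-above = trans (sym (map-∘ τ))
        (map-cong (λ t → trans (cong (_∸ (i + t)) (sym (+-suc i m))) ([m+n]∸[m+o]≡n∸o i (suc m) t)) τ)

  lhsShuffle≈hProduct : ∀ I → lhsShuffle I ≈ hProduct I
  lhsShuffle≈hProduct []      = ⊕-identityʳ 1#
  lhsShuffle≈hProduct (i ∷ I) = begin
    Σ[ shuffle (i ∷ I) ] (mono ∘ Sc)                    ≈⟨ Σ-↭ (mono ∘ Sc) (shuffle-∷↭shuffleMerges i I) ⟩
    Σ[ shuffleMerges i I ] (mono ∘ Sc)                  ≈⟨ Σ-concatMap (mergesWithBlock i) T (mono ∘ Sc) ⟩
    Σ[ T ] (λ τ → Σ[ mergesWithBlock i τ ] (mono ∘ Sc)) ≈⟨ Σ-cong-local T (Σ-mergesWithBlock i (sum I) ∘ ∈shuffle⇒IsPerm I) ⟩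
    Σ[ T ] (λ τ → h i (sum I) ⊗ mono (Sc τ))            ≈⟨ Σ-*ˡ T (mono ∘ Sc) (h i (sum I)) ⟩
    h i (sum I) ⊗ lhsShuffle I                          ≈⟨ *-congˡ (lhsShuffle≈hProduct I) ⟩
    h i (sum I) ⊗ hProduct I                            ∎
    where T = shuffle I

  lhsD≈lhsShuffle : ∀ I → lhsD I ≈ lhsShuffle I
  lhsD≈lhsShuffle I = begin
    Σ[ filter (inDLeq? I) P ] (mono ∘ Sc ∘ inv) ≈⟨ Σ-filter (inDLeq? I) P (mono ∘ Sc ∘ inv) ⟩
    Σ[ P ] restrictD                            ≈⟨ Σ-↭ restrictD (map-inv-perms↭ N) ⟨
    Σ[ map inv P ] restrictD                    ≡⟨ Σ-map inv P restrictD ⟩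
    Σ[ P ] (restrictD ∘ inv)                    ≈⟨ Σ-cong-local P (≈-reflexive ∘ restrictD-inv) ⟩
    Σ[ P ] restrictShuffle                      ≈⟨ Σ-filter (inShuffle? I) P (mono ∘ Sc) ⟨
    Σ[ filter (inShuffle? I) P ] (mono ∘ Sc)    ∎
    where
    N = sum I
    P = perms N
    restrictD restrictShuffle : List ℕ → Carrier
    restrictD σ = if does (inDLeq? I σ) then mono (Sc (inv σ)) else 0#
    restrictShuffle σ = if does (inShuffle? I σ) then mono (Sc σ) else 0#
    restrictD-inv : ∀ {σ} → σ ∈ P → restrictD (inv σ) ≡ restrictShuffle σ
    restrictD-inv {σ} σ∈ = cong₂ (λ b τ → if b then mono (Sc τ) else 0#)
      (does-⇔ (inDLeq-inv⇔inShuffle I σ pσ) (inDLeq? I (inv σ)) (inShuffle? I σ))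
      (inv-involutive pσ)
      where pσ = ∈perms⁻ N σ∈

mainTheorem3 : (R : CommutativeSemiring 0ℓ 0ℓ) (x : ℕ → CommutativeSemiring.Carrier R)
    (I : List ℕ) → All (λ i → 1 ≤ i) I →
    let open CommutativeSemiring R using (_≈_) in
    let open Poly R x in
    (lhsD I ≈ lhsShuffle I) × (lhsShuffle I ≈ hProduct I)
mainTheorem3 R x I _ = lhsD≈lhsShuffle I , lhsShuffle≈hProduct I
  where open Evaluation R x
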